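{- Let $\overline{P}$ be an $r$-partite hypergraph that is constructible by conditioning using $k$ doublings (and an arbitrary number of collapses), and let $\overline{Q}$ be another $r$-partite hypergraph with $M:=|\overline{Q}|$ hyperedges. Put $C=2^k$. Then there exists a probability distribution $\mathcal{H}$ over $\mathrm{Hom}(\overline{P},\overline{Q})$ such that: (1) for every $n\ge1$, if $f_1,\dots,f_n$ are sampled i.i.d. from $\mathcal{H}$ and $\underline{f}=(f_1,\dots,f_n)$, then for every $S\subseteq\overline{Q}^n$, $$\Pr\left[\forall\overline{p}\in\overline{P}:\ \underline{f}(\overline{p})\in S\right]\ge\mu(S)^C;$$ (2) $\min_{f\in\mathrm{Hom}(\overline{P},\overline{Q})}\mathcal{H}(f)\ge 1/M^C$.
   Context: An $r$-partite hypergraph $(Q^{(1)},\dots,Q^{(r)},\overline{Q})$ has finite pairwise disjoint vertex classes $Q^{(j)}$ and a nonempty set of hyperedges $\overline{Q}\subseteq Q^{(1)}\times\cdots\times Q^{(r)}$, every vertex lying in some hyperedge; it is identified with the hyperedge set $\overline{Q}$. A homomorphism from $(P^{(1)},\dots,P^{(r)},\overline{P})$ to $(Q^{(1)},\dots,Q^{(r)},\overline{Q})$ is $f=(f^{(1)},\dots,f^{(r)})$ with $f^{(j)}:P^{(j)}\to Q^{(j)}$ such that $\overline{p}=(p^{(1)},\dots,p^{(r)})\in\overline{P}$ implies $f(\overline{p}):=(f^{(1)}(p^{(1)}),\dots,f^{(r)}(p^{(r)}))\in\overline{Q}$; $\mathrm{Hom}(\overline{P},\overline{Q})$ is the set of these.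 For $\underline{f}=(f_1,\dots,f_n)$, $\underline{f}(\overline{p}):=(f_1(\overline{p}),\dots,f_n(\overline{p}))\in\overline{Q}^n$. For $S\subseteq\overline{Q}^n$, $\mu(S)=|S|/M^n$. For $P^{(j)}\subseteq Q^{(j)}$ the section hypergraph is $(P^{(1)},\dots,P^{(r)},\overline{P})$ with $\overline{P}$ the hyperedges of $\overline{Q}$ all of whose vertices lie in $\bigcup_j P^{(j)}$. Constructible by conditioning (recursively, up to renaming of vertices); a construction is a sequence of operations starting from a single hyperedge: (1) A single hyperedge $(\{q^{(1)}\},\dots,\{q^{(r)}\},\{(q^{(1)},\dots,q^{(r)})\})$ is constructible. (2) Doubling: if $(P^{(1)}\sqcup Q^{(1)},\dots,P^{(r)}\sqcup Q^{(r)},\overline{P})$ is constructible, let $R^{(j)}=\{q':q\in Q^{(j)}\}$ be fresh copies (vertices of $P^{(j)}$ fixed, of $Q^{(j)}$ old, of $R^{(j)}$ new). For $\overline{q}\in\overline{P}$ not all of whose vertices are fixed, $\overline{q}'$ replaces each old vertex by its copy. Then the hypergraph with classes $P^{(j)}\sqcup Q^{(j)}\sqcup R^{(j)}$ and hyperedge set $\overline{P}\cup\{\overline{q}':\overline{q}\in\overline{P}\text{ not all of whose vertices are fixed}\}$ is constructible. (3) Collapse: if $(P^{(1)}\sqcup Q^{(1)},\dots,P^{(r)}\sqcup Q^{(r)},\overline{Q})$ is constructible, $(P^{(1)},\dots,P^{(r)},\overline{P})$ is its section hypergraph on the $P^{(j)}$, and some homomorphism from $\overline{Q}$ to $\overline{P}$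 is the identity on $\bigcup_j P^{(j)}$, then $(P^{(1)},\dots,P^{(r)},\overline{P})$ is constructible. -}

module Defs where

open import Data.Nat as ℕ using (ℕ; zero; suc; _^_)
open import Data.Integer using (+_)
open import Data.Rational as ℚ using (ℚ; 0ℚ; 1ℚ; _≤_; _/_)
open import Data.Bool using (Bool; true; false; _∧_; if_then_else_; T; T?)
open import Data.Fin using (Fin; zero; suc; _↑ˡ_; _↑ʳ_; splitAt)
open import Data.Sum using (inj₁; inj₂)
open import Data.Maybe using (Maybe; just; nothing)
open import Data.Unit using (⊤; tt)
open import Data.Product using (_×_; _,_; Σ; ∃)
open import Data.Vec as Vec using (Vec; []; _∷_; lookup; tabulate; zipWith; replicate)
open import Data.List as List using (List; []; _∷_; [_]; _++_; concatMap; allFin; filter; mapMaybe; length; foldr)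
open import Data.List.Membership.Propositional using (_∈_)
open import Data.List.Relation.Binary.Subset.Propositional using (_⊆_)
open import Data.List.Relation.Unary.All as All using (All)
open import Data.List.Relation.Unary.Any using (Any)
open import Data.Vec.Relation.Unary.All using () renaming (All to VAll)
open import Data.List.Relation.Unary.Unique.Propositional using (Unique)
open import Relation.Binary.PropositionalEquality using (_≡_; _≢_)
open import Relation.Nullary using (¬_)

-- Raw r-partite data.  Vertex class j of a hypergraph with size vector
-- s : Vec ℕ r is Fin (lookup s j).  A tuple in Q^(1) × ... × Q^(r) is a
-- nested product.

Tuple : ∀ {r} → Vec ℕ r → Set
Tuple []       = ⊤
Tuple (a ∷ s)  = Fin a × Tuple s

comp : ∀ {r} {s : Vec ℕ r} → Tuple s → (j : Fin r) → Fin (lookup s j)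
comp {s = a ∷ s} (x , t) zero    = x
comp {s = a ∷ s} (x , t) (suc j) = comp t j

-- A family (f^(1),...,f^(r)) of maps f^(j) : Fin (s j) → Fin (s' j),
-- each map stored canonically as the vector of its values.
Maps : ∀ {r} → Vec ℕ r → Vec ℕ r → Set
Maps []      []       = ⊤
Maps (a ∷ s) (b ∷ s') = Vec (Fin b) a × Maps s s'

mapAt : ∀ {r} {s s' : Vec ℕ r} → Maps s s' → (j : Fin r) →
        Fin (lookup s j) → Fin (lookup s' j)
mapAt {s = a ∷ s} {b ∷ s'} (f , g) zero    x = lookup f x
mapAt {s = a ∷ s} {b ∷ s'} (f , g) (suc j) x = mapAt g j x

apply : ∀ {r} {s s' : Vec ℕ r} → Maps s s' → Tuple s → Tuple s'
apply {s = []}    {[]}     tt      tt      = tt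
apply {s = a ∷ s} {b ∷ s'} (f , g) (x , t) = lookup f x , apply g t

record Hypergraph (r : ℕ) : Set where
  field
    sizes    : Vec ℕ r
    edges    : List (Tuple sizes)
    unique   : Unique edges
    nonempty : edges ≢ []
    covered  : ∀ (j : Fin r) (x : Fin (lookup sizes j)) →
               Any (λ e → comp e j ≡ x) edges
open Hypergraph public

IsHom : ∀ {r} (P Q : Hypergraph r) → Maps (sizes P) (sizes Q) → Set
IsHom P Q f = All (λ p → apply f p ∈ edges Q) (edges P)

singleEdge : ∀ r → Tuple (replicate r 1)
singleEdge zero    = tt
singleEdge (suc r) = zero , singleEdge r

-- Doubling.  Class j is Fin (a_j + b_j): the first a_j vertices are
-- fixed, the last b_j are old.  After doubling, class j is
-- Fin (a_j + (b_j + b_j)): fixed, old, new copies.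
oldV : ∀ a b → Fin (a ℕ.+ b) → Fin (a ℕ.+ (b ℕ.+ b))
oldV a b x with splitAt a x
... | inj₁ i = i ↑ˡ (b ℕ.+ b)
... | inj₂ y = a ↑ʳ (y ↑ˡ b)

copyV : ∀ a b → Fin (a ℕ.+ b) → Fin (a ℕ.+ (b ℕ.+ b))
copyV a b x with splitAt a x
... | inj₁ i = i ↑ˡ (b ℕ.+ b)
... | inj₂ y = a ↑ʳ (b ↑ʳ y)

isFixed : ∀ a b → Fin (a ℕ.+ b) → Bool
isFixed a b x with splitAt a x
... | inj₁ _ = true
... | inj₂ _ = false

oldMaps : ∀ {r} (a b : Vec ℕ r) →
          Maps (zipWith ℕ._+_ a b) (zipWith ℕ._+_ a (zipWith ℕ._+_ b b))
oldMaps []      []      = tt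
oldMaps (a ∷ as) (b ∷ bs) = tabulate (oldV a b) , oldMaps as bs

copyMaps : ∀ {r} (a b : Vec ℕ r) →
           Maps (zipWith ℕ._+_ a b) (zipWith ℕ._+_ a (zipWith ℕ._+_ b b))
copyMaps []      []       = tt
copyMaps (a ∷ as) (b ∷ bs) = tabulate (copyV a b) , copyMaps as bs

allFixed : ∀ {r} (a b : Vec ℕ r) → Tuple (zipWith ℕ._+_ a b) → Bool
allFixed []       []       tt      = true
allFixed (a ∷ as) (b ∷ bs) (x , t) = isFixed a b x ∧ allFixed as bs t

notAllFixed : ∀ {r} (a b : Vec ℕ r) → Tuple (zipWith ℕ._+_ a b) → Bool
notAllFixed a b t = if allFixed a b t then false else true

doubleEdges : ∀ {r} (a b : Vec ℕ r) → List (Tuple (zipWith ℕ._+_ a b)) →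
              List (Tuple (zipWith ℕ._+_ a (zipWith ℕ._+_ b b)))
doubleEdges a b E =
  List.map (apply (oldMaps a b)) E ++
  List.map (apply (copyMaps a b)) (filter (λ t → T? (notAllFixed a b t)) E)

restrict : ∀ {r} (a b : Vec ℕ r) → Tuple (zipWith ℕ._+_ a b) → Maybe (Tuple a)
restrict []       []       tt      = just tt
restrict (a ∷ as) (b ∷ bs) (x , t) with splitAt a x | restrict as bs t
... | inj₁ i | just u = just (i , u)
... | _      | _      = nothing

section : ∀ {r} (a b : Vec ℕ r) → List (Tuple (zipWith ℕ._+_ a b)) → List (Tuple a)
section a b E = mapMaybe (restrict a b) E

IdOnFixed : ∀ {r} (a b : Vec ℕ r) → Maps (zipWith ℕ._+_ a b) a → Set
IdOnFixed {r} a b g =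
  ∀ (j : Fin r) (i : Fin (lookup a j)) →
    mapAt g j (castIn {a = a} {b} j i) ≡ i
  where
  castIn : ∀ {r} {a b : Vec ℕ r} (j : Fin r) → Fin (lookup a j) →
           Fin (lookup (zipWith ℕ._+_ a b) j)
  castIn {a = a ∷ as} {b ∷ bs} zero    i = i ↑ˡ b
  castIn {a = a ∷ as} {b ∷ bs} (suc j) i = castIn {a = as} {bs} j i

record Renaming {r} (s s' : Vec ℕ r) : Set where
  field
    to     : Maps s s'
    from   : Maps s' s
    from∘to : ∀ j x → mapAt from j (mapAt to j x) ≡ x
    to∘from : ∀ j y → mapAt to j (mapAt from j y) ≡ y

-- Constructible k s E : the hypergraph with class sizes s and hyperedge
-- set (the set of elements of) E is constructible by conditioning using
-- exactly k doublings (and any number of collapses and renamings).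
data Constructible {r : ℕ} : ℕ → (s : Vec ℕ r) → List (Tuple s) → Set where
  single   : Constructible 0 (replicate r 1) [ singleEdge r ]
  doubling : ∀ {k} (a b : Vec ℕ r) (E : List (Tuple (zipWith ℕ._+_ a b))) →
             Constructible k (zipWith ℕ._+_ a b) E →
             Constructible (suc k) (zipWith ℕ._+_ a (zipWith ℕ._+_ b b))
                           (doubleEdges a b E)
  collapse : ∀ {k} (a b : Vec ℕ r) (E : List (Tuple (zipWith ℕ._+_ a b))) →
             Constructible k (zipWith ℕ._+_ a b) E →
             (g : Maps (zipWith ℕ._+_ a b) a) →
             IdOnFixed a b g →
             All (λ e → apply g e ∈ section a b E) E →
             Constructible k a (section a b E)
  rename   : ∀ {k} {s s' : Vec ℕ r} (E : List (Tuple s)) (E' : List (Tuple s')) →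
             Constructible k s E →
             (σ : Renaming s s') →
             List.map (apply (Renaming.to σ)) E ⊆ E' →
             E' ⊆ List.map (apply (Renaming.to σ)) E →
             Constructible k s' E'

ConstructibleHG : ∀ {r} → ℕ → Hypergraph r → Set
ConstructibleHG k P = Constructible k (sizes P) (edges P)

allVec : ∀ {A : Set} → List A → (n : ℕ) → List (Vec A n)
allVec xs zero    = [ [] ]
allVec xs (suc n) = concatMap (λ x → List.map (x ∷_) (allVec xs n)) xs

allTuples : ∀ {r} (s : Vec ℕ r) → List (Tuple s)
allTuples []      = [ tt ]
allTuples (a ∷ s) = concatMap (λ x → List.map (x ,_) (allTuples s)) (allFin a)

allMaps : ∀ {r} (s s' : Vec ℕ r) → List (Maps s s')
allMaps []      []       = [ tt ]
allMaps (a ∷ s) (b ∷ s') =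
  concatMap (λ f → List.map (f ,_) (allMaps s s')) (allVec (allFin b) a)

sumℚ : List ℚ → ℚ
sumℚ = foldr ℚ._+_ 0ℚ

prodVecℚ : ∀ {n} → Vec ℚ n → ℚ
prodVecℚ = Vec.foldr _ ℚ._*_ 1ℚ

powℚ : ℚ → ℕ → ℚ
powℚ q zero    = 1ℚ
powℚ q (suc n) = q ℚ.* powℚ q n

-- the fraction a / d (d ≠ 0 in all uses; d = 0 gives 0)
frac : ℕ → ℕ → ℚ
frac a zero    = 0ℚ
frac a (suc d) = (+ a) / suc d

count : ∀ {A : Set} → (A → Bool) → List A → ℕ
count p xs = length (filter (λ x → T? (p x)) xs)

allB : ∀ {A : Set} → (A → Bool) → List A → Bool
allB p = foldr (λ x b → p x ∧ b) true

numEdges : ∀ {r} → Hypergraph r → ℕ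
numEdges Q = length (edges Q)

μ : ∀ {r} (Q : Hypergraph r) (n : ℕ) → (Vec (Tuple (sizes Q)) n → Bool) → ℚ
μ Q n S = frac (count S (allVec (allTuples (sizes Q)) n)) (numEdges Q ^ n)

IsDistribution : ∀ {r} (P Q : Hypergraph r) → (Maps (sizes P) (sizes Q) → ℚ) → Set
IsDistribution P Q H =
  (∀ f → 0ℚ ≤ H f) ×
  (∀ f → ¬ IsHom P Q f → H f ≡ 0ℚ) ×
  (sumℚ (List.map H (allMaps (sizes P) (sizes Q))) ≡ 1ℚ)

probAll : ∀ {r} (P Q : Hypergraph r) → (Maps (sizes P) (sizes Q) → ℚ) →
          (n : ℕ) → (Vec (Tuple (sizes Q)) n → Bool) → ℚ
probAll P Q H n S =
  sumℚ (List.map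
    (λ fs → prodVecℚ (Vec.map H fs) ℚ.*
            (if allB (λ p → S (Vec.map (λ f → apply f p) fs)) (edges P)
             then 1ℚ else 0ℚ))
    (allVec (allMaps (sizes P) (sizes Q)) n))

SubsetQn : ∀ {r} (Q : Hypergraph r) (n : ℕ) → (Vec (Tuple (sizes Q)) n → Bool) → Set
SubsetQn Q n S = ∀ xs → T (S xs) → VAll (λ x → x ∈ edges Q) xs

-- Induction on the construction, carrying a distribution H on families of maps into Q̄ that vanishes
-- off Hom(E, Q̄), gives every homomorphism weight at least M^(-2^k), and satisfies
-- Pr[f₁,…,fₙ send every edge of E into S] ≥ μ(S)^(2^k).  A single edge takes the uniform distribution
-- on Q̄, and a renaming transports H.  A collapse along a retraction g marginalises H onto the fixed
-- vertices; the weight floor survives because h ∘ g is a homomorphism extending h.  A doubling draws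
-- the fixed part φ from the marginal w of H and then the old part and its copy independently given φ.
-- If a(φ) is the probability that the fixed part is φ and the old event holds, the doubled event has
-- probability at least ∑_φ a(φ)²/w(φ) ≥ (∑_φ a(φ))² by Cauchy–Schwarz; this works for n samples
-- because the n-fold product of such a coupling is the coupling of the n-fold product.  A doubled
-- homomorphism weighs H·H/w ≥ M^(-2^k)·M^(-2^k), as w ≤ 1.

module Submission where

open import Defs
open import Data.Nat using (ℕ; _^_)
open import Data.Rational using (ℚ; _≤_)
open import Data.Product using (Σ; _×_)
open import Data.Vec using (Vec)
open import Data.Bool using (Bool)

open import Algebra.Bundles using (CommutativeMonoid)
open import Data.Bool using (true; false; _∧_; if_then_else_; T; T?)
open import Data.Bool.Properties using (T-∧)
open import Data.Empty using (⊥-elim)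
open import Data.Fin as Fin using (Fin; _↑ˡ_; _↑ʳ_)
import Data.Fin.Properties as Fin
import Data.Integer as ℤ
import Data.Integer.Properties as ℤ
open import Data.List as List using (List; []; _∷_; _++_; concatMap; filter)
import Data.List.Properties as List
open import Data.List.Membership.Propositional using (_∈_)
open import Data.List.Membership.Propositional.Properties
  using (∈-allFin; ∈-cartesianProductWith⁺; ∈-map⁺; ∈-map⁻; ∈-filter⁺; ∈-filter⁻)
open import Data.List.Membership.Propositional.Properties.WithK using (unique∧set⇒bag)
import Data.List.Membership.DecPropositional as DecMembership
open import Data.List.Relation.Binary.BagAndSetEquality using (∼bag⇒↭)
open import Data.List.Relation.Binary.Permutation.Propositional using (_↭_; ↭⇒↭ₛ)
import Data.List.Relation.Binary.Permutation.Propositional.Properties as Perm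
open import Data.List.Relation.Binary.Permutation.Setoid.Properties using (foldr-commMonoid)
open import Data.List.Relation.Binary.Subset.Propositional using (_⊆_)
import Data.List.Relation.Unary.All as All
open All using (All)
import Data.List.Relation.Unary.All.Properties as AllP
import Data.List.Relation.Unary.AllPairs as AllPairs
open import Data.List.Relation.Unary.Any using (here; there)
open import Data.List.Relation.Unary.Unique.Propositional using (Unique)
import Data.List.Relation.Unary.Unique.Propositional.Properties as Unique
open import Data.Maybe using (just; nothing)
import Data.Maybe.Relation.Unary.All as Maybe
open import Data.Nat as ℕ using (zero; suc)
import Data.Nat.Properties as ℕ
open import Data.Product using (∃; _,_; proj₁; proj₂)
open import Data.Product.Properties using (,-injective; ≡-dec)
open import Data.Rational using (0ℚ; 1ℚ; _+_; _*_; -_; _-_; _<_; 1/_; _≟_; fromℚᵘ; nonNegative; ≢-nonZero)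
open import Data.Rational.Properties
import Data.Rational.Unnormalised as ℚᵘ
import Data.Rational.Unnormalised.Properties as ℚᵘ
open import Data.Sum using (inj₁; inj₂)
open import Data.Unit using (tt)
import Data.Unit.Properties as Unit
open import Data.Vec as Vec using ([]; _∷_; lookup; tabulate; zipWith)
import Data.Vec.Properties as Vec
import Data.Vec.Relation.Unary.All as VAll
open VAll using () renaming (All to VAll)
open import Function using (_∘_; _⇔_; mk⇔; Equivalence)
open import Relation.Binary.Definitions using (DecidableEquality)
open import Relation.Binary.PropositionalEquality
open import Relation.Nullary using (Dec; yes; no; does; ¬_)
open import Relation.Nullary.Decidable using (dec⇒maybe)
open import Relation.Unary using (Decidable)
open import Tactic.RingSolver using (solve-∀)
open import Tactic.RingSolver.Core.AlmostCommutativeRing using (AlmostCommutativeRing; fromCommutativeRing)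

open import Algebra.Properties.CommutativeSemigroup
  (CommutativeMonoid.commutativeSemigroup +-0-commutativeMonoid)
  using () renaming (interchange to +-interchange)
open import Algebra.Properties.CommutativeSemigroup
  (CommutativeMonoid.commutativeSemigroup *-1-commutativeMonoid)
  using (xy∙z≈xz∙y) renaming (interchange to *-interchange)

private variable
  A B C : Set
  m n : ℕ

∑ : List A → (A → ℚ) → ℚ
∑ xs f = sumℚ (List.map f xs)

syntax ∑ xs (λ x → e) = ∑[ x ∈ xs ] e

∑-++ : ∀ (xs ys : List A) f → ∑ (xs ++ ys) f ≡ ∑ xs f + ∑ ys f
∑-++ []       ys f = sym (+-identityˡ _)
∑-++ (x ∷ xs) ys f = trans (cong (f x +_) (∑-++ xs ys f)) (sym (+-assoc (f x) _ _))

∑-map : ∀ (g : A → B) xs f → ∑ (List.map g xs) f ≡ ∑ xs (f ∘ g)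
∑-map g []       f = refl
∑-map g (x ∷ xs) f = cong (f (g x) +_) (∑-map g xs f)

∑-cong : ∀ (xs : List A) {f g} → (∀ x → f x ≡ g x) → ∑ xs f ≡ ∑ xs g
∑-cong xs f≗g = cong sumℚ (List.map-cong f≗g xs)

∑-concatMap : ∀ (g : A → List B) xs f → ∑ (concatMap g xs) f ≡ ∑[ x ∈ xs ] ∑ (g x) f
∑-concatMap g []       f = refl
∑-concatMap g (x ∷ xs) f = trans (∑-++ (g x) _ f) (cong (∑ (g x) f +_) (∑-concatMap g xs f))

∑-concatMap-map : ∀ (g : A → B → C) xs ys f →
  ∑ (concatMap (λ x → List.map (g x) ys) xs) f ≡ ∑[ x ∈ xs ] ∑[ y ∈ ys ] f (g x y)
∑-concatMap-map g xs ys f =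
  trans (∑-concatMap _ xs f) (∑-cong xs (λ x → ∑-map (g x) ys f))

∑-[] : ∀ (x : A) f → ∑ List.[ x ] f ≡ f x
∑-[] x f = +-identityʳ (f x)

∑-zero : ∀ (xs : List A) → ∑[ x ∈ xs ] 0ℚ ≡ 0ℚ
∑-zero []       = refl
∑-zero (x ∷ xs) = trans (+-identityˡ _) (∑-zero xs)

∑-+ : ∀ (xs : List A) f g → ∑[ x ∈ xs ] (f x + g x) ≡ ∑ xs f + ∑ xs g
∑-+ []       f g = sym (+-identityˡ 0ℚ)
∑-+ (x ∷ xs) f g = trans (cong (f x + g x +_) (∑-+ xs f g))
  (+-interchange (f x) (g x) (∑ xs f) (∑ xs g))

∑-*ˡ : ∀ (xs : List A) c f → ∑[ x ∈ xs ] (c * f x) ≡ c * ∑ xs f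
∑-*ˡ []       c f = sym (*-zeroʳ c)
∑-*ˡ (x ∷ xs) c f = trans (cong (c * f x +_) (∑-*ˡ xs c f)) (sym (*-distribˡ-+ c (f x) _))

∑-*ʳ : ∀ (xs : List A) c f → ∑[ x ∈ xs ] (f x * c) ≡ ∑ xs f * c
∑-*ʳ xs c f = trans (∑-cong xs (λ x → *-comm (f x) c)) (trans (∑-*ˡ xs c f) (*-comm c _))

∑-comm : ∀ (xs : List A) (ys : List B) (f : A → B → ℚ) →
  ∑[ x ∈ xs ] ∑[ y ∈ ys ] f x y ≡ ∑[ y ∈ ys ] ∑[ x ∈ xs ] f x y
∑-comm []       ys f = sym (∑-zero ys)
∑-comm (x ∷ xs) ys f =
  trans (cong (∑ ys (f x) +_) (∑-comm xs ys f)) (sym (∑-+ ys (f x) (λ y → ∑[ x ∈ xs ] f x y)))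

∑-∑-* : ∀ (xs : List A) (ys : List B) f g c →
  ∑[ x ∈ xs ] ∑[ y ∈ ys ] (f x * g y * c) ≡ ∑ xs f * ∑ ys g * c
∑-∑-* xs ys f g c = begin
  ∑[ x ∈ xs ] ∑[ y ∈ ys ] (f x * g y * c)   ≡⟨ ∑-cong xs (λ x → ∑-cong ys (λ y → xy∙z≈xz∙y (f x) (g y) c)) ⟩
  ∑[ x ∈ xs ] ∑[ y ∈ ys ] (f x * c * g y)   ≡⟨ ∑-cong xs (λ x → ∑-*ˡ ys (f x * c) g) ⟩
  ∑[ x ∈ xs ] (f x * c * ∑ ys g)            ≡⟨ ∑-*ʳ xs (∑ ys g) (λ x → f x * c) ⟩
  ∑[ x ∈ xs ] (f x * c) * ∑ ys g            ≡⟨ cong (_* ∑ ys g) (∑-*ʳ xs c f) ⟩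
  ∑ xs f * c * ∑ ys g                       ≡⟨ xy∙z≈xz∙y (∑ xs f) c (∑ ys g) ⟩
  ∑ xs f * ∑ ys g * c                       ∎
  where open ≡-Reasoning

∑-mono-≤ : ∀ (xs : List A) {f g} → (∀ x → f x ≤ g x) → ∑ xs f ≤ ∑ xs g
∑-mono-≤ []       f≤g = ≤-refl
∑-mono-≤ (x ∷ xs) f≤g = +-mono-≤ (f≤g x) (∑-mono-≤ xs f≤g)

∑-nonneg : ∀ (xs : List A) {f} → (∀ x → 0ℚ ≤ f x) → 0ℚ ≤ ∑ xs f
∑-nonneg xs 0≤f = ≤-trans (≤-reflexive (sym (∑-zero xs))) (∑-mono-≤ xs 0≤f)

∈⇒≤∑ : ∀ {xs : List A} {f x} → (∀ y → 0ℚ ≤ f y) → x ∈ xs → f x ≤ ∑ xs f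
∈⇒≤∑ {xs = y ∷ xs} {f} 0≤f (here refl) =
  ≤-trans (≤-reflexive (sym (+-identityʳ (f y)))) (+-monoʳ-≤ (f y) (∑-nonneg xs 0≤f))
∈⇒≤∑ {xs = y ∷ xs} {f} 0≤f (there x∈) =
  ≤-trans (≤-reflexive (sym (+-identityˡ (f _)))) (+-mono-≤ (0≤f y) (∈⇒≤∑ 0≤f x∈))

∑-↭ : ∀ {xs ys : List A} f → xs ↭ ys → ∑ xs f ≡ ∑ ys f
∑-↭ f xs↭ys = foldr-commMonoid (setoid ℚ) +-0-isCommutativeMonoid (↭⇒↭ₛ (Perm.map⁺ f xs↭ys))

∑-filter : ∀ {P : A → Set} (P? : Decidable P) xs f →
  ∑[ x ∈ xs ] (if does (P? x) then f x else 0ℚ) ≡ ∑ (filter P? xs) f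
∑-filter P? []       f = refl
∑-filter P? (x ∷ xs) f with does (P? x)
... | true  = cong (f x +_) (∑-filter P? xs f)
... | false = trans (+-identityˡ _) (∑-filter P? xs f)

ℚ-ring : AlmostCommutativeRing _ _
ℚ-ring = fromCommutativeRing +-*-commutativeRing (λ p → dec⇒maybe (0ℚ ≟ p))

𝟙 : Bool → ℚ
𝟙 b = if b then 1ℚ else 0ℚ

𝟙-∧ : ∀ b c → 𝟙 (b ∧ c) ≡ 𝟙 b * 𝟙 c
𝟙-∧ true  c = sym (*-identityˡ (𝟙 c))
𝟙-∧ false c = sym (*-zeroˡ (𝟙 c))

𝟙-nonneg : ∀ b → 0ℚ ≤ 𝟙 b
𝟙-nonneg true  = nonNegative⁻¹ 1ℚ
𝟙-nonneg false = ≤-refl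

𝟙-mono : ∀ {b c} → (T b → T c) → 𝟙 b ≤ 𝟙 c
𝟙-mono {true}  {true}  _   = ≤-refl
𝟙-mono {true}  {false} b⇒c = ⊥-elim (b⇒c tt)
𝟙-mono {false} {c}     _   = 𝟙-nonneg c

*-nonneg : ∀ {p q} → 0ℚ ≤ p → 0ℚ ≤ q → 0ℚ ≤ p * q
*-nonneg {p} {q} 0≤p 0≤q =
  nonNegative⁻¹ _ {{nonNeg*nonNeg⇒nonNeg p {{nonNegative 0≤p}} q {{nonNegative 0≤q}}}}

*-mono-≤-nonneg : ∀ {p p′ q q′} → 0ℚ ≤ p → 0ℚ ≤ q → p ≤ p′ → q ≤ q′ → p * q ≤ p′ * q′
*-mono-≤-nonneg {p} {p′} {q} {q′} 0≤p 0≤q p≤p′ q≤q′ =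
  ≤-trans (*-monoˡ-≤-nonNeg p {{nonNegative 0≤p}} q≤q′)
          (*-monoʳ-≤-nonNeg q′ {{nonNegative (≤-trans 0≤q q≤q′)}} p≤p′)

square-nonneg : ∀ p → 0ℚ ≤ p * p
square-nonneg p with ≤-total 0ℚ p
... | inj₁ 0≤p = *-nonneg 0≤p 0≤p
... | inj₂ p≤0 = subst (0ℚ ≤_) (neg-square p) (*-nonneg 0≤-p 0≤-p)
  where
  0≤-p : 0ℚ ≤ - p
  0≤-p = neg-antimono-≤ p≤0
  neg-square : ∀ p → - p * - p ≡ p * p
  neg-square = solve-∀ ℚ-ring

powℚ-+ : ∀ p m n → powℚ p (m ℕ.+ n) ≡ powℚ p m * powℚ p n
powℚ-+ p zero    n = sym (*-identityˡ _)
powℚ-+ p (suc m) n = trans (cong (p *_) (powℚ-+ p m n)) (sym (*-assoc p _ _))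

powℚ-2^suc : ∀ p k → powℚ p (2 ^ suc k) ≡ powℚ p (2 ^ k) * powℚ p (2 ^ k)
powℚ-2^suc p k = trans (cong (λ m → powℚ p (2 ^ k ℕ.+ m)) (ℕ.+-identityʳ (2 ^ k))) (powℚ-+ p (2 ^ k) (2 ^ k))

powℚ-nonneg : ∀ {p} n → 0ℚ ≤ p → 0ℚ ≤ powℚ p n
powℚ-nonneg zero    0≤p = 𝟙-nonneg true
powℚ-nonneg (suc n) 0≤p = *-nonneg 0≤p (powℚ-nonneg n 0≤p)

fromℚᵘ-homo-* : ∀ u v → fromℚᵘ (u ℚᵘ.* v) ≡ fromℚᵘ u * fromℚᵘ v
fromℚᵘ-homo-* u v = toℚᵘ-injective (ℚᵘ.≃-trans (toℚᵘ-fromℚᵘ (u ℚᵘ.* v))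
  (ℚᵘ.≃-sym (ℚᵘ.≃-trans (toℚᵘ-homo-* (fromℚᵘ u) (fromℚᵘ v))
                        (ℚᵘ.*-cong (toℚᵘ-fromℚᵘ u) (toℚᵘ-fromℚᵘ v)))))

fromℚᵘ-homo-+ : ∀ u v → fromℚᵘ (u ℚᵘ.+ v) ≡ fromℚᵘ u + fromℚᵘ v
fromℚᵘ-homo-+ u v = toℚᵘ-injective (ℚᵘ.≃-trans (toℚᵘ-fromℚᵘ (u ℚᵘ.+ v))
  (ℚᵘ.≃-sym (ℚᵘ.≃-trans (toℚᵘ-homo-+ (fromℚᵘ u) (fromℚᵘ v))
                        (ℚᵘ.+-cong (toℚᵘ-fromℚᵘ u) (toℚᵘ-fromℚᵘ v)))))

frac-* : ∀ x y a b .{{_ : ℕ.NonZero a}} .{{_ : ℕ.NonZero b}} →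
         frac x a * frac y b ≡ frac (x ℕ.* y) (a ℕ.* b)
frac-* x y (suc a) (suc b) = sym (trans
  (cong (λ z → fromℚᵘ (ℚᵘ.mkℚᵘ z (b ℕ.+ a ℕ.* suc b))) (ℤ.pos-* x y))
  (fromℚᵘ-homo-* (ℚᵘ.mkℚᵘ (ℤ.+ x) a) (ℚᵘ.mkℚᵘ (ℤ.+ y) b)))

frac-+ : ∀ x y → frac x 1 + frac y 1 ≡ frac (x ℕ.+ y) 1
frac-+ x y = sym (trans
  (fromℚᵘ-cong {ℚᵘ.mkℚᵘ (ℤ.+ (x ℕ.+ y)) 0} {ℚᵘ.mkℚᵘ (ℤ.+ x) 0 ℚᵘ.+ ℚᵘ.mkℚᵘ (ℤ.+ y) 0} (ℚᵘ.*≡* same-fraction))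
  (fromℚᵘ-homo-+ (ℚᵘ.mkℚᵘ (ℤ.+ x) 0) (ℚᵘ.mkℚᵘ (ℤ.+ y) 0)))
  where
  same-fraction : ℤ.+ (x ℕ.+ y) ℤ.* (ℤ.+ 1 ℤ.* ℤ.+ 1) ≡ (ℤ.+ x ℤ.* ℤ.+ 1 ℤ.+ ℤ.+ y ℤ.* ℤ.+ 1) ℤ.* ℤ.+ 1
  same-fraction = begin
    ℤ.+ (x ℕ.+ y) ℤ.* ℤ.+ 1             ≡⟨ ℤ.*-identityʳ _ ⟩
    ℤ.+ x ℤ.+ ℤ.+ y                     ≡⟨ sym (cong₂ ℤ._+_ (ℤ.*-identityʳ (ℤ.+ x)) (ℤ.*-identityʳ (ℤ.+ y))) ⟩
    ℤ.+ x ℤ.* ℤ.+ 1 ℤ.+ ℤ.+ y ℤ.* ℤ.+ 1 ≡⟨ sym (ℤ.*-identityʳ _) ⟩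
    _                                    ∎
    where open ≡-Reasoning

frac-self : ∀ d .{{_ : ℕ.NonZero d}} → frac d d ≡ 1ℚ
frac-self (suc d) = fromℚᵘ-cong {ℚᵘ.mkℚᵘ (ℤ.+ suc d) d} {ℚᵘ.mkℚᵘ (ℤ.+ 1) 0} (ℚᵘ.*≡* (ℤ.*-comm (ℤ.+ suc d) (ℤ.+ 1)))

frac-nonneg : ∀ a d → 0ℚ ≤ frac a d
frac-nonneg a zero    = ≤-refl
frac-nonneg a (suc d) = nonNegative⁻¹ _ {{normalize-nonNeg a (suc d)}}

frac-1-pos : ∀ d .{{_ : ℕ.NonZero d}} → 0ℚ < frac 1 d
frac-1-pos (suc d) = positive⁻¹ _ {{normalize-pos 1 (suc d)}}

powℚ-frac-1 : ∀ d n .{{_ : ℕ.NonZero d}} → powℚ (frac 1 d) n ≡ frac 1 (d ^ n)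
powℚ-frac-1 d zero    = refl
powℚ-frac-1 d (suc n) = trans (cong (frac 1 d *_) (powℚ-frac-1 d n))
  (frac-* 1 1 d (d ^ n))
  where instance _ = ℕ.m^n≢0 d n

-- 1/p extended by the junk value inv 0 = 0, so that conditioning on a null event needs no case split.
inv : ℚ → ℚ
inv p with p ≟ 0ℚ
... | yes _   = 0ℚ
... | no p≢0 = (1/ p) {{≢-nonZero p≢0}}

*-inv : ∀ p → p ≢ 0ℚ → p * inv p ≡ 1ℚ
*-inv p p≢0 with p ≟ 0ℚ
... | yes p≡0 = ⊥-elim (p≢0 p≡0)
... | no p≢0′ = *-inverseʳ p {{≢-nonZero p≢0′}}

*-*-inv : ∀ p → p * (p * inv p) ≡ p
*-*-inv p with p ≟ 0ℚ
... | yes refl = refl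
... | no p≢0  = trans (cong (p *_) (*-inverseʳ p {{≢-nonZero p≢0}})) (*-identityʳ p)

≤-*-inv : ∀ {p q} → 0ℚ ≤ p → p ≤ q → p * (q * inv q) ≡ p
≤-*-inv {p} {q} 0≤p p≤q with q ≟ 0ℚ
... | yes refl = trans (*-zeroʳ p) (≤-antisym 0≤p p≤q)
... | no q≢0  = trans (cong (p *_) (*-inverseʳ q {{≢-nonZero q≢0}})) (*-identityʳ p)

inv-* : ∀ p q → inv (p * q) ≡ inv p * inv q
inv-* p q with p ≟ 0ℚ
... | yes refl = trans (cong inv (*-zeroˡ q)) (sym (*-zeroˡ (inv q)))
... | no p≢0 with q ≟ 0ℚ
...   | yes refl = trans (cong inv (*-zeroʳ p)) (sym (*-zeroʳ ((1/ p) {{≢-nonZero p≢0}})))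
...   | no q≢0   = begin
  inv (p * q)                          ≡⟨ sym (*-identityʳ _) ⟩
  inv (p * q) * 1ℚ                     ≡⟨ cong (inv (p * q) *_) (sym pq-1/p1/q) ⟩
  inv (p * q) * ((p * q) * (p⁻¹ * q⁻¹)) ≡⟨ sym (*-assoc (inv (p * q)) (p * q) _) ⟩
  (inv (p * q) * (p * q)) * (p⁻¹ * q⁻¹) ≡⟨ cong (_* (p⁻¹ * q⁻¹)) (trans (*-comm _ (p * q)) (*-inv (p * q) pq≢0)) ⟩
  1ℚ * (p⁻¹ * q⁻¹)                     ≡⟨ *-identityˡ _ ⟩
  p⁻¹ * q⁻¹                            ∎
  where
  open ≡-Reasoning
  instance
    _ = ≢-nonZero p≢0
    _ = ≢-nonZero q≢0
  p⁻¹ = 1/ p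
  q⁻¹ = 1/ q
  pq-1/p1/q : (p * q) * (p⁻¹ * q⁻¹) ≡ 1ℚ
  pq-1/p1/q = trans (*-interchange p q p⁻¹ q⁻¹)
    (trans (cong₂ _*_ (*-inverseʳ p) (*-inverseʳ q)) (*-identityˡ 1ℚ))
  pq≢0 : p * q ≢ 0ℚ
  pq≢0 pq≡0 = 1≢0 (trans (sym pq-1/p1/q) (trans (cong (_* (p⁻¹ * q⁻¹)) pq≡0) (*-zeroˡ (p⁻¹ * q⁻¹))))

inv-nonneg : ∀ {p} → 0ℚ ≤ p → 0ℚ ≤ inv p
inv-nonneg {p} 0≤p with p ≟ 0ℚ
... | yes _   = ≤-refl
... | no p≢0 = <⇒≤ (positive⁻¹ _ {{1/pos⇒pos p {{p>0}}}})
  where p>0 = nonNeg∧nonZero⇒pos p {{nonNegative 0≤p}} {{≢-nonZero p≢0}}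

1≤inv : ∀ {p} → 0ℚ < p → p ≤ 1ℚ → 1ℚ ≤ inv p
1≤inv {p} 0<p p≤1 = begin
  1ℚ            ≡⟨ sym (*-inv p (≢-sym (<⇒≢ 0<p))) ⟩
  p * inv p     ≤⟨ *-monoʳ-≤-nonNeg (inv p) {{nonNegative (inv-nonneg (<⇒≤ 0<p))}} p≤1 ⟩
  1ℚ * inv p    ≡⟨ *-identityˡ _ ⟩
  inv p         ∎
  where open ≤-Reasoning

0≤p-q⇒q≤p : ∀ {p q} → 0ℚ ≤ p - q → q ≤ p
0≤p-q⇒q≤p {p} {q} 0≤p-q = begin
  q             ≡⟨ sym (+-identityʳ q) ⟩
  q + 0ℚ        ≤⟨ +-monoʳ-≤ q 0≤p-q ⟩
  q + (p - q)   ≡⟨ q+[p-q]≡p p q ⟩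
  p             ∎
  where
  open ≤-Reasoning
  q+[p-q]≡p : ∀ p q → q + (p - q) ≡ p
  q+[p-q]≡p = solve-∀ ℚ-ring

-- Cauchy–Schwarz and conditional couplings

-- a ≤ W forces a x = 0 wherever W x = 0, where inv takes its junk value.
weighted-Cauchy-Schwarz : ∀ (xs : List A) (a W : A → ℚ) →
  (∀ x → 0ℚ ≤ a x) → (∀ x → a x ≤ W x) → ∑ xs W ≡ 1ℚ →
  ∑ xs a * ∑ xs a ≤ ∑[ x ∈ xs ] (inv (W x) * (a x * a x))
weighted-Cauchy-Schwarz xs a W 0≤a a≤W ∑W≡1 =
  0≤p-q⇒q≤p (subst (0ℚ ≤_) ∑-deviation (∑-nonneg xs deviation-nonneg))
  where
  Σa = ∑ xs a
  R = ∑[ x ∈ xs ] (inv (W x) * (a x * a x))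
  deviation : _ → ℚ
  deviation x = inv (W x) * ((a x - Σa * W x) * (a x - Σa * W x))
  deviation-nonneg : ∀ x → 0ℚ ≤ deviation x
  deviation-nonneg x = *-nonneg (inv-nonneg (≤-trans (0≤a x) (a≤W x))) (square-nonneg (a x - Σa * W x))
  expand : ∀ u a w t → u * ((a - t * w) * (a - t * w)) ≡
                       u * (a * a) + - (t + t) * (a * (w * u)) + t * t * (w * (w * u))
  expand = solve-∀ ℚ-ring
  deviation-expand : ∀ x → deviation x ≡ inv (W x) * (a x * a x) + - (Σa + Σa) * a x + Σa * Σa * W x
  deviation-expand x = trans (expand (inv (W x)) (a x) (W x) Σa)
    (cong₂ (λ p q → inv (W x) * (a x * a x) + - (Σa + Σa) * p + Σa * Σa * q)
           (≤-*-inv (0≤a x) (a≤W x)) (*-*-inv (W x)))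
  collect : ∀ R t → R + - (t + t) * t + t * t * 1ℚ ≡ R - t * t
  collect = solve-∀ ℚ-ring
  ∑-deviation : ∑ xs deviation ≡ R - Σa * Σa
  ∑-deviation = begin
    ∑ xs deviation                                           ≡⟨ ∑-cong xs deviation-expand ⟩
    ∑[ x ∈ xs ] (inv (W x) * (a x * a x) + - (Σa + Σa) * a x + Σa * Σa * W x)
      ≡⟨ trans (∑-+ xs _ _) (cong₂ _+_ (∑-+ xs _ _) (∑-*ˡ xs (Σa * Σa) W)) ⟩
    R + ∑[ x ∈ xs ] (- (Σa + Σa) * a x) + Σa * Σa * ∑ xs W
      ≡⟨ cong₂ (λ p q → R + p + Σa * Σa * q) (∑-*ˡ xs (- (Σa + Σa)) a) ∑W≡1 ⟩
    R + - (Σa + Σa) * Σa + Σa * Σa * 1ℚ                           ≡⟨ collect R Σa ⟩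
    R - Σa * Σa                                                ∎
    where open ≡-Reasoning

module _ {X Y : Set} (ys : List Y) (H : X → Y → ℚ) where

  marginal : X → ℚ
  marginal x = ∑ ys (H x)

  -- x is drawn from the marginal of H, then y and y′ independently from H conditioned on x.
  coupling : X → Y → Y → ℚ
  coupling x y y′ = H x y * H x y′ * inv (marginal x)

  coupling-nonneg : (∀ x y → 0ℚ ≤ H x y) → ∀ x y y′ → 0ℚ ≤ coupling x y y′
  coupling-nonneg 0≤H x y y′ =
    *-nonneg (*-nonneg (0≤H x y) (0≤H x y′)) (inv-nonneg (∑-nonneg ys (0≤H x)))

  ∑-coupling : ∀ x → ∑[ y ∈ ys ] ∑[ y′ ∈ ys ] coupling x y y′ ≡ marginal x
  ∑-coupling x = trans (∑-∑-* ys ys (H x) (H x) _)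
    (trans (*-assoc (marginal x) (marginal x) _) (*-*-inv (marginal x)))

  coupling-square : ∀ (xs : List X) → (∀ x y → 0ℚ ≤ H x y) → ∑ xs marginal ≡ 1ℚ →
    ∀ (e : X → Y → Bool) → let Pr = ∑[ x ∈ xs ] ∑[ y ∈ ys ] (H x y * 𝟙 (e x y)) in
    Pr * Pr ≤ ∑[ x ∈ xs ] ∑[ y ∈ ys ] ∑[ y′ ∈ ys ] (coupling x y y′ * 𝟙 (e x y ∧ e x y′))
  coupling-square xs 0≤H ∑marginal≡1 e = begin
    ∑ xs Pr∣ * ∑ xs Pr∣
      ≤⟨ weighted-Cauchy-Schwarz xs Pr∣ marginal Pr∣-nonneg Pr∣≤marginal ∑marginal≡1 ⟩
    ∑[ x ∈ xs ] (inv (marginal x) * (Pr∣ x * Pr∣ x))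
      ≡⟨ ∑-cong xs (λ x → sym (trans (∑-∑-* ys ys _ _ _) (*-comm _ (inv (marginal x))))) ⟩
    ∑[ x ∈ xs ] ∑[ y ∈ ys ] ∑[ y′ ∈ ys ] (H x y * 𝟙 (e x y) * (H x y′ * 𝟙 (e x y′)) * inv (marginal x))
      ≡⟨ ∑-cong xs (λ x → ∑-cong ys (λ y → ∑-cong ys (λ y′ → rearrange x y y′))) ⟩
    ∑[ x ∈ xs ] ∑[ y ∈ ys ] ∑[ y′ ∈ ys ] (coupling x y y′ * 𝟙 (e x y ∧ e x y′)) ∎
    where
    open ≤-Reasoning
    Pr∣ : X → ℚ
    Pr∣ x = ∑[ y ∈ ys ] (H x y * 𝟙 (e x y))
    Pr∣-nonneg : ∀ x → 0ℚ ≤ Pr∣ x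
    Pr∣-nonneg x = ∑-nonneg ys (λ y → *-nonneg (0≤H x y) (𝟙-nonneg (e x y)))
    Pr∣≤marginal : ∀ x → Pr∣ x ≤ marginal x
    Pr∣≤marginal x = ∑-mono-≤ ys (λ y → begin
      H x y * 𝟙 (e x y) ≤⟨ *-monoˡ-≤-nonNeg (H x y) {{nonNegative (0≤H x y)}} (𝟙-mono {c = true} _) ⟩
      H x y * 1ℚ        ≡⟨ *-identityʳ (H x y) ⟩
      H x y             ∎)
    regroup : ∀ h h′ i i′ c → h * i * (h′ * i′) * c ≡ h * h′ * c * (i * i′)
    regroup = solve-∀ ℚ-ring
    rearrange : ∀ x y y′ → H x y * 𝟙 (e x y) * (H x y′ * 𝟙 (e x y′)) * inv (marginal x) ≡
                           coupling x y y′ * 𝟙 (e x y ∧ e x y′)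
    rearrange x y y′ = trans (regroup (H x y) (H x y′) (𝟙 (e x y)) (𝟙 (e x y′)) (inv (marginal x)))
                             (cong (coupling x y y′ *_) (sym (𝟙-∧ (e x y) (e x y′))))

concatMap-map≡cartesianProductWith : ∀ (f : A → B → C) xs ys →
  concatMap (λ x → List.map (f x) ys) xs ≡ List.cartesianProductWith f xs ys
concatMap-map≡cartesianProductWith f []       ys = refl
concatMap-map≡cartesianProductWith f (x ∷ xs) ys =
  cong (List.map (f x) ys ++_) (concatMap-map≡cartesianProductWith f xs ys)

Unique-concatMap-map : ∀ (f : A → B → C) → (∀ {w x y z} → f w y ≡ f x z → w ≡ x × y ≡ z) →
  ∀ {xs ys} → Unique xs → Unique ys → Unique (concatMap (λ x → List.map (f x) ys) xs)
Unique-concatMap-map f f-injective {xs} {ys} xs! ys! =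
  subst Unique (sym (concatMap-map≡cartesianProductWith f xs ys))
        (Unique.cartesianProductWith⁺ f f-injective xs! ys!)

∈-concatMap-map : ∀ (f : A → B → C) {xs ys x y} → x ∈ xs → y ∈ ys →
  f x y ∈ concatMap (λ x → List.map (f x) ys) xs
∈-concatMap-map f {xs} {ys} x∈ y∈ =
  subst (_ ∈_) (sym (concatMap-map≡cartesianProductWith f xs ys)) (∈-cartesianProductWith⁺ f x∈ y∈)

Unique-[] : ∀ (x : A) → Unique List.[ x ]
Unique-[] x = All.[] AllPairs.∷ AllPairs.[]

Unique-allVec : ∀ {xs : List A} → Unique xs → ∀ n → Unique (allVec xs n)
Unique-allVec xs! zero    = Unique-[] []
Unique-allVec xs! (suc n) = Unique-concatMap-map _∷_ Vec.∷-injective xs! (Unique-allVec xs! n)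

∈-allVec : ∀ {xs : List A} → (∀ x → x ∈ xs) → ∀ {n} (v : Vec A n) → v ∈ allVec xs n
∈-allVec ∈xs []      = here refl
∈-allVec ∈xs (x ∷ v) = ∈-concatMap-map _∷_ (∈xs x) (∈-allVec ∈xs v)

Unique-allTuples : ∀ {r} (s : Vec ℕ r) → Unique (allTuples s)
Unique-allTuples []      = Unique-[] tt
Unique-allTuples (a ∷ s) = Unique-concatMap-map _,_ ,-injective (Unique.allFin⁺ a) (Unique-allTuples s)

∈-allTuples : ∀ {r} (s : Vec ℕ r) t → t ∈ allTuples s
∈-allTuples []      tt      = here refl
∈-allTuples (a ∷ s) (x , t) = ∈-concatMap-map _,_ (∈-allFin x) (∈-allTuples s t)

Unique-allMaps : ∀ {r} (s t : Vec ℕ r) → Unique (allMaps s t)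
Unique-allMaps []      []      = Unique-[] tt
Unique-allMaps (a ∷ s) (b ∷ t) =
  Unique-concatMap-map _,_ ,-injective (Unique-allVec (Unique.allFin⁺ b) a) (Unique-allMaps s t)

∈-allMaps : ∀ {r} (s t : Vec ℕ r) f → f ∈ allMaps s t
∈-allMaps []      []      tt      = here refl
∈-allMaps (a ∷ s) (b ∷ t) (f , g) = ∈-concatMap-map _,_ (∈-allVec ∈-allFin f) (∈-allMaps s t g)

Tuple-≟ : ∀ {r} (s : Vec ℕ r) → DecidableEquality (Tuple s)
Tuple-≟ []      = Unit._≟_
Tuple-≟ (a ∷ s) = ≡-dec Fin._≟_ (Tuple-≟ s)

∑-same-elements : ∀ {xs ys : List A} f → Unique xs → Unique ys →
  (∀ {x} → x ∈ xs ⇔ x ∈ ys) → ∑ xs f ≡ ∑ ys f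
∑-same-elements f xs! ys! xs≈ys = ∑-↭ f (∼bag⇒↭ (unique∧set⇒bag xs! ys! xs≈ys))

∑-reindex : ∀ {xs : List A} {ys : List B} (ρ : A → B) (ρ⁻¹ : B → A) →
  (∀ x → ρ⁻¹ (ρ x) ≡ x) → (∀ y → ρ (ρ⁻¹ y) ≡ y) →
  Unique xs → Unique ys → (∀ x → x ∈ xs) → (∀ y → y ∈ ys) →
  ∀ f → ∑[ x ∈ xs ] f (ρ x) ≡ ∑ ys f
∑-reindex {xs = xs} {ys} ρ ρ⁻¹ left right xs! ys! ∈xs ∈ys f =
  trans (sym (∑-map ρ xs f))
        (∑-same-elements f (Unique.map⁺ ρ-injective xs!) ys! (mk⇔ (λ _ → ∈ys _) ∈-image))
  where
  ρ-injective : ∀ {x x′} → ρ x ≡ ρ x′ → x ≡ x′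
  ρ-injective {x} {x′} eq = trans (sym (left x)) (trans (cong ρ⁻¹ eq) (left x′))
  ∈-image : ∀ {y} → y ∈ ys → y ∈ List.map ρ xs
  ∈-image {y} _ = subst (_∈ List.map ρ xs) (right y) (∈-map⁺ ρ (∈xs (ρ⁻¹ y)))

∑-restrict : ∀ (_≟ᴬ_ : DecidableEquality A) {xs ys : List A} → Unique xs → Unique ys →
  (∀ x → x ∈ xs) → ∀ f →
  ∑[ x ∈ xs ] (if does (DecMembership._∈?_ _≟ᴬ_ x ys) then f x else 0ℚ) ≡ ∑ ys f
∑-restrict _≟ᴬ_ {xs} {ys} xs! ys! ∈xs f = trans (∑-filter (_∈? ys) xs f)
  (∑-same-elements f (Unique.filter⁺ (_∈? ys) xs!) ys!
    (mk⇔ (proj₂ ∘ ∈-filter⁻ (_∈? ys) {xs = xs}) (∈-filter⁺ (_∈? ys) (∈xs _))))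
  where open DecMembership _≟ᴬ_ using (_∈?_)

∑-𝟙 : ∀ (p : A → Bool) xs → ∑[ x ∈ xs ] 𝟙 (p x) ≡ frac (count p xs) 1
∑-𝟙 p []       = refl
∑-𝟙 p (x ∷ xs) with p x
... | true  = trans (cong (1ℚ +_) (∑-𝟙 p xs)) (frac-+ 1 (count p xs))
... | false = trans (+-identityˡ _) (∑-𝟙 p xs)

∑-const : ∀ (xs : List A) c → ∑[ x ∈ xs ] c ≡ frac (List.length xs) 1 * c
∑-const []       c = sym (*-zeroˡ c)
∑-const (x ∷ xs) c = begin
  c + ∑[ x ∈ xs ] c                        ≡⟨ cong₂ _+_ (sym (*-identityˡ c)) (∑-const xs c) ⟩
  1ℚ * c + frac (List.length xs) 1 * c     ≡⟨ sym (*-distribʳ-+ c 1ℚ (frac (List.length xs) 1)) ⟩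
  (1ℚ + frac (List.length xs) 1) * c       ≡⟨ cong (_* c) (frac-+ 1 (List.length xs)) ⟩
  frac (suc (List.length xs)) 1 * c        ∎
  where open ≡-Reasoning

-- Independent samples

map-zipWith : ∀ {D : Set} (h : C → D) (j : A → B → C) (us : Vec A n) vs →
  Vec.map h (zipWith j us vs) ≡ zipWith (λ u v → h (j u v)) us vs
map-zipWith h j []       []       = refl
map-zipWith h j (u ∷ us) (v ∷ vs) = cong (h (j u v) ∷_) (map-zipWith h j us vs)

∏ : (A → ℚ) → Vec A n → ℚ
∏ H xs = prodVecℚ (Vec.map H xs)

∏-nonneg : ∀ {H : A → ℚ} → (∀ x → 0ℚ ≤ H x) → (xs : Vec A n) → 0ℚ ≤ ∏ H xs
∏-nonneg 0≤H []       = 𝟙-nonneg true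
∏-nonneg 0≤H (x ∷ xs) = *-nonneg (0≤H x) (∏-nonneg 0≤H xs)

∑-allVec-total : ∀ {xs : List A} {H} → ∑ xs H ≡ 1ℚ → ∀ n → ∑[ as ∈ allVec xs n ] ∏ H as ≡ 1ℚ
∑-allVec-total ∑H≡1 zero    = +-identityʳ 1ℚ
∑-allVec-total {xs = xs} {H} ∑H≡1 (suc n) = begin
  ∑ (allVec xs (suc n)) (∏ H)                    ≡⟨ ∑-concatMap-map _∷_ xs (allVec xs n) (∏ H) ⟩
  ∑[ x ∈ xs ] ∑[ as ∈ allVec xs n ] (H x * ∏ H as) ≡⟨ ∑-cong xs (λ x → ∑-*ˡ (allVec xs n) (H x) (∏ H)) ⟩
  ∑[ x ∈ xs ] (H x * ∑ (allVec xs n) (∏ H))       ≡⟨ ∑-cong xs (λ x → cong (H x *_) (∑-allVec-total ∑H≡1 n)) ⟩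
  ∑[ x ∈ xs ] (H x * 1ℚ)                          ≡⟨ ∑-cong xs (λ x → *-identityʳ (H x)) ⟩
  ∑ xs H                                          ≡⟨ ∑H≡1 ⟩
  1ℚ                                              ∎
  where open ≡-Reasoning

∑-allVec-∏ : ∀ {ys : List B} (G : A → B → ℚ) (as : Vec A n) →
  ∑[ bs ∈ allVec ys n ] prodVecℚ (zipWith G as bs) ≡ ∏ (λ a → ∑ ys (G a)) as
∑-allVec-∏ G []                 = +-identityʳ 1ℚ
∑-allVec-∏ {n = suc n} {ys = ys} G (a ∷ as) = begin
  ∑ (allVec ys (suc n)) (λ bs → prodVecℚ (zipWith G (a ∷ as) bs))
    ≡⟨ ∑-concatMap-map _∷_ ys (allVec ys n) _ ⟩
  ∑[ b ∈ ys ] ∑[ bs ∈ allVec ys n ] (G a b * prodVecℚ (zipWith G as bs))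
    ≡⟨ ∑-cong ys (λ b → trans (∑-*ˡ (allVec ys n) (G a b) _) (cong (G a b *_) (∑-allVec-∏ G as))) ⟩
  ∑[ b ∈ ys ] (G a b * ∏ (λ a → ∑ ys (G a)) as)
    ≡⟨ ∑-*ʳ ys _ (G a) ⟩
  ∏ (λ a → ∑ ys (G a)) (a ∷ as) ∎
  where open ≡-Reasoning

∑-allVec-map : ∀ {xs : List A} {ys : List B} (τ : A → B) →
  (∀ F → ∑[ x ∈ xs ] F (τ x) ≡ ∑ ys F) →
  ∀ n G → ∑[ as ∈ allVec xs n ] G (Vec.map τ as) ≡ ∑ (allVec ys n) G
∑-allVec-map τ ∑τ zero    G = refl
∑-allVec-map {xs = xs} {ys} τ ∑τ (suc n) G = begin
  ∑[ as ∈ allVec xs (suc n) ] G (Vec.map τ as)                 ≡⟨ ∑-concatMap-map _∷_ xs (allVec xs n) _ ⟩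
  ∑[ x ∈ xs ] ∑[ as ∈ allVec xs n ] G (τ x ∷ Vec.map τ as)     ≡⟨ ∑-cong xs (λ x → ∑-allVec-map τ ∑τ n (G ∘ (τ x ∷_))) ⟩
  ∑[ x ∈ xs ] ∑[ bs ∈ allVec ys n ] G (τ x ∷ bs)              ≡⟨ ∑τ (λ y → ∑[ bs ∈ allVec ys n ] G (y ∷ bs)) ⟩
  ∑[ y ∈ ys ] ∑[ bs ∈ allVec ys n ] G (y ∷ bs)                ≡⟨ sym (∑-concatMap-map _∷_ ys (allVec ys n) G) ⟩
  ∑ (allVec ys (suc n)) G                                      ∎
  where open ≡-Reasoning

∑-allVec-zipWith : ∀ {xs : List C} {as : List A} {bs : List B} (j : A → B → C) →
  (∀ F → ∑ xs F ≡ ∑[ a ∈ as ] ∑[ b ∈ bs ] F (j a b)) →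
  ∀ n G → ∑ (allVec xs n) G ≡ ∑[ us ∈ allVec as n ] ∑[ vs ∈ allVec bs n ] G (zipWith j us vs)
∑-allVec-zipWith j ∑j zero G = sym (+-identityʳ _)
∑-allVec-zipWith {xs = xs} {as} {bs} j ∑j (suc n) G = begin
  ∑ (allVec xs (suc n)) G
    ≡⟨ ∑-concatMap-map _∷_ xs (allVec xs n) G ⟩
  ∑[ x ∈ xs ] ∑[ ws ∈ allVec xs n ] G (x ∷ ws)
    ≡⟨ ∑j _ ⟩
  ∑[ a ∈ as ] ∑[ b ∈ bs ] ∑[ ws ∈ allVec xs n ] G (j a b ∷ ws)
    ≡⟨ ∑-cong as (λ a → ∑-cong bs (λ b → ∑-allVec-zipWith j ∑j n (G ∘ (j a b ∷_)))) ⟩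
  ∑[ a ∈ as ] ∑[ b ∈ bs ] ∑[ us ∈ allVec as n ] ∑[ vs ∈ allVec bs n ] G (j a b ∷ zipWith j us vs)
    ≡⟨ ∑-cong as (λ a → ∑-comm bs (allVec as n) _) ⟩
  ∑[ a ∈ as ] ∑[ us ∈ allVec as n ] ∑[ b ∈ bs ] ∑[ vs ∈ allVec bs n ] G (j a b ∷ zipWith j us vs)
    ≡⟨ sym (∑-concatMap-map _∷_ as (allVec as n) _) ⟩
  ∑[ us ∈ allVec as (suc n) ] ∑[ b ∈ bs ] ∑[ vs ∈ allVec bs n ] G (zipWith j us (b ∷ vs))
    ≡⟨ sym (∑-cong (allVec as (suc n)) (λ us → ∑-concatMap-map _∷_ bs (allVec bs n) _)) ⟩
  ∑[ us ∈ allVec as (suc n) ] ∑[ vs ∈ allVec bs (suc n) ] G (zipWith j us vs) ∎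
  where open ≡-Reasoning

∑-allVec-++ : ∀ {xs : List A} m n F →
  ∑ (allVec xs (m ℕ.+ n)) F ≡ ∑[ u ∈ allVec xs m ] ∑[ w ∈ allVec xs n ] F (u Vec.++ w)
∑-allVec-++ zero    n F = sym (+-identityʳ _)
∑-allVec-++ {xs = xs} (suc m) n F = begin
  ∑ (allVec xs (suc m ℕ.+ n)) F
    ≡⟨ ∑-concatMap-map _∷_ xs (allVec xs (m ℕ.+ n)) F ⟩
  ∑[ x ∈ xs ] ∑[ v ∈ allVec xs (m ℕ.+ n) ] F (x ∷ v)
    ≡⟨ ∑-cong xs (λ x → ∑-allVec-++ m n (F ∘ (x ∷_))) ⟩
  ∑[ x ∈ xs ] ∑[ u ∈ allVec xs m ] ∑[ w ∈ allVec xs n ] F (x ∷ u Vec.++ w)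
    ≡⟨ sym (∑-concatMap-map _∷_ xs (allVec xs m) _) ⟩
  ∑[ u ∈ allVec xs (suc m) ] ∑[ w ∈ allVec xs n ] F (u Vec.++ w) ∎
  where open ≡-Reasoning

𝔼 : List A → (A → ℚ) → (n : ℕ) → (Vec A n → ℚ) → ℚ
𝔼 xs H n F = ∑[ as ∈ allVec xs n ] (∏ H as * F as)

𝔼-mono-≤ : ∀ {xs : List A} {H} → (∀ x → 0ℚ ≤ H x) → ∀ {n F G} → (∀ as → F as ≤ G as) →
  𝔼 xs H n F ≤ 𝔼 xs H n G
𝔼-mono-≤ {xs = xs} 0≤H {n} F≤G =
  ∑-mono-≤ (allVec xs n) (λ as → *-monoˡ-≤-nonNeg (∏ _ as) {{nonNegative (∏-nonneg 0≤H as)}} (F≤G as))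

𝔼-map : ∀ {xs : List A} {ys : List B} (ρ : A → B) → (∀ F → ∑[ x ∈ xs ] F (ρ x) ≡ ∑ ys F) →
  ∀ H n F → 𝔼 xs (H ∘ ρ) n (F ∘ Vec.map ρ) ≡ 𝔼 ys H n F
𝔼-map {xs = xs} ρ ∑ρ H n F = trans
  (∑-cong (allVec xs n) (λ as → cong (λ hs → prodVecℚ hs * F (Vec.map ρ as)) (Vec.map-∘ H ρ as)))
  (∑-allVec-map ρ ∑ρ n (λ bs → ∏ H bs * F bs))

𝔼-split : ∀ {xs : List C} {as : List A} {bs : List B} (j : A → B → C) →
  (∀ F → ∑ xs F ≡ ∑[ a ∈ as ] ∑[ b ∈ bs ] F (j a b)) → ∀ H n F →
  𝔼 xs H n F ≡ ∑[ us ∈ allVec as n ] ∑[ vs ∈ allVec bs n ]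
                 (prodVecℚ (zipWith (λ a b → H (j a b)) us vs) * F (zipWith j us vs))
𝔼-split {as = as} {bs} j ∑j H n F = trans (∑-allVec-zipWith j ∑j n _)
  (∑-cong (allVec as n) λ us → ∑-cong (allVec bs n) λ vs →
    cong (λ hs → prodVecℚ hs * F (zipWith j us vs)) (map-zipWith H j us vs))

𝔼-marginal : ∀ {xs : List C} {as : List A} {bs : List B} (j : A → B → C) (π : C → A) →
  (∀ a b → π (j a b) ≡ a) → (∀ F → ∑ xs F ≡ ∑[ a ∈ as ] ∑[ b ∈ bs ] F (j a b)) → ∀ H n F →
  𝔼 xs H n (F ∘ Vec.map π) ≡ 𝔼 as (marginal bs (λ a b → H (j a b))) n F
𝔼-marginal {as = as} {bs} j π π∘j ∑j H n F = begin
  𝔼 _ H n (F ∘ Vec.map π)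
    ≡⟨ 𝔼-split j ∑j H n (F ∘ Vec.map π) ⟩
  ∑[ us ∈ allVec as n ] ∑[ vs ∈ allVec bs n ] (Hⁿ us vs * F (Vec.map π (zipWith j us vs)))
    ≡⟨ ∑-cong (allVec as n) (λ us → ∑-cong (allVec bs n) (λ vs → cong (λ ws → Hⁿ us vs * F ws) (π∘zipWith us vs))) ⟩
  ∑[ us ∈ allVec as n ] ∑[ vs ∈ allVec bs n ] (Hⁿ us vs * F us)
    ≡⟨ ∑-cong (allVec as n) (λ us → trans (∑-*ʳ (allVec bs n) (F us) (Hⁿ us)) (cong (_* F us) (∑-allVec-∏ _ us))) ⟩
  𝔼 as (marginal bs (λ a b → H (j a b))) n F ∎
  where
  open ≡-Reasoning
  Hⁿ : Vec _ n → Vec _ n → ℚ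
  Hⁿ us vs = prodVecℚ (zipWith (λ a b → H (j a b)) us vs)
  π∘zipWith : ∀ {m} (us : Vec _ m) vs → Vec.map π (zipWith j us vs) ≡ us
  π∘zipWith []       []       = refl
  π∘zipWith (u ∷ us) (v ∷ vs) = cong₂ _∷_ (π∘j u v) (π∘zipWith us vs)

tabulate-↑ˡ-++ : ∀ (u : Vec A m) (w : Vec A n) → tabulate (λ i → lookup (u Vec.++ w) (i ↑ˡ n)) ≡ u
tabulate-↑ˡ-++ u w = trans (Vec.tabulate-cong (Vec.lookup-++ˡ u w)) (Vec.tabulate∘lookup u)

tabulate-↑ʳ-++ : ∀ (u : Vec A m) (w : Vec A n) → tabulate (λ j → lookup (u Vec.++ w) (m ↑ʳ j)) ≡ w
tabulate-↑ʳ-++ u w = trans (Vec.tabulate-cong (Vec.lookup-++ʳ u w)) (Vec.tabulate∘lookup w)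

tabulate-↑-++ : ∀ m (v : Vec A (m ℕ.+ n)) →
  tabulate (λ i → lookup v (i ↑ˡ n)) Vec.++ tabulate (λ j → lookup v (m ↑ʳ j)) ≡ v
tabulate-↑-++ m v with Vec.splitAt m v
... | u , w , refl = cong₂ Vec._++_ (tabulate-↑ˡ-++ u w) (tabulate-↑ʳ-++ u w)

_⊕_ : ∀ {r} {a b t : Vec ℕ r} → Maps a t → Maps b t → Maps (zipWith ℕ._+_ a b) t
_⊕_ {a = []}    {b = []}    {t = []}    tt      tt      = tt
_⊕_ {a = _ ∷ _} {b = _ ∷ _} {t = _ ∷ _} (u , φ) (w , ψ) = u Vec.++ w , φ ⊕ ψ

takeᴹ : ∀ {r} {a b t : Vec ℕ r} → Maps (zipWith ℕ._+_ a b) t → Maps a t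
takeᴹ {a = []}    {b = []}     {t = []}    tt      = tt
takeᴹ {a = _ ∷ _} {b = b ∷ bs} {t = _ ∷ _} (v , f) = tabulate (λ i → lookup v (i ↑ˡ b)) , takeᴹ {b = bs} f

dropᴹ : ∀ {r} {a b t : Vec ℕ r} → Maps (zipWith ℕ._+_ a b) t → Maps b t
dropᴹ {a = []}     {b = []}    {t = []}    tt      = tt
dropᴹ {a = a ∷ as} {b = _ ∷ _} {t = _ ∷ _} (v , f) = tabulate (λ j → lookup v (a ↑ʳ j)) , dropᴹ {a = as} f

takeᴹ-⊕ : ∀ {r} {a b t : Vec ℕ r} (φ : Maps a t) (ψ : Maps b t) → takeᴹ {b = b} (φ ⊕ ψ) ≡ φ
takeᴹ-⊕ {a = []}    {b = []}    {t = []}    tt      tt      = refl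
takeᴹ-⊕ {a = _ ∷ _} {b = _ ∷ _} {t = _ ∷ _} (u , φ) (w , ψ) = cong₂ _,_ (tabulate-↑ˡ-++ u w) (takeᴹ-⊕ φ ψ)

dropᴹ-⊕ : ∀ {r} {a b t : Vec ℕ r} (φ : Maps a t) (ψ : Maps b t) → dropᴹ {a = a} (φ ⊕ ψ) ≡ ψ
dropᴹ-⊕ {a = []}    {b = []}    {t = []}    tt      tt      = refl
dropᴹ-⊕ {a = _ ∷ _} {b = _ ∷ _} {t = _ ∷ _} (u , φ) (w , ψ) = cong₂ _,_ (tabulate-↑ʳ-++ u w) (dropᴹ-⊕ φ ψ)

takeᴹ⊕dropᴹ : ∀ {r} {a b t : Vec ℕ r} (f : Maps (zipWith ℕ._+_ a b) t) → takeᴹ {b = b} f ⊕ dropᴹ {a = a} f ≡ f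
takeᴹ⊕dropᴹ {a = []}    {b = []}    {t = []}    tt      = refl
takeᴹ⊕dropᴹ {a = a ∷ _} {b = _ ∷ _} {t = _ ∷ _} (v , f) = cong₂ _,_ (tabulate-↑-++ a v) (takeᴹ⊕dropᴹ f)

∑-allMaps-⊕ : ∀ {r} (a b t : Vec ℕ r) F →
  ∑ (allMaps (zipWith ℕ._+_ a b) t) F ≡ ∑[ φ ∈ allMaps a t ] ∑[ ψ ∈ allMaps b t ] F (φ ⊕ ψ)
∑-allMaps-⊕ []       []       []       F = trans (∑-[] tt F) (sym (trans (∑-[] tt _) (∑-[] tt _)))
∑-allMaps-⊕ (a ∷ as) (b ∷ bs) (c ∷ cs) F = begin
  ∑ (allMaps (zipWith ℕ._+_ (a ∷ as) (b ∷ bs)) (c ∷ cs)) F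
    ≡⟨ ∑-concatMap-map _,_ (allVec cs′ (a ℕ.+ b)) (allMaps (zipWith ℕ._+_ as bs) cs) F ⟩
  ∑[ v ∈ allVec cs′ (a ℕ.+ b) ] ∑[ f ∈ allMaps (zipWith ℕ._+_ as bs) cs ] F (v , f)
    ≡⟨ ∑-allVec-++ a b _ ⟩
  ∑[ u ∈ allVec cs′ a ] ∑[ w ∈ allVec cs′ b ] ∑[ f ∈ allMaps (zipWith ℕ._+_ as bs) cs ] F (u Vec.++ w , f)
    ≡⟨ ∑-cong (allVec cs′ a) (λ u → ∑-cong (allVec cs′ b) (λ w → ∑-allMaps-⊕ as bs cs _)) ⟩
  ∑[ u ∈ allVec cs′ a ] ∑[ w ∈ allVec cs′ b ] ∑[ φ ∈ allMaps as cs ] ∑[ ψ ∈ allMaps bs cs ] F ((u , φ) ⊕ (w , ψ))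
    ≡⟨ ∑-cong (allVec cs′ a) (λ u → ∑-comm (allVec cs′ b) (allMaps as cs) _) ⟩
  ∑[ u ∈ allVec cs′ a ] ∑[ φ ∈ allMaps as cs ] ∑[ w ∈ allVec cs′ b ] ∑[ ψ ∈ allMaps bs cs ] F ((u , φ) ⊕ (w , ψ))
    ≡⟨ sym (∑-concatMap-map _,_ (allVec cs′ a) (allMaps as cs) _) ⟩
  ∑[ φ ∈ allMaps (a ∷ as) (c ∷ cs) ] ∑[ w ∈ allVec cs′ b ] ∑[ ψ ∈ allMaps bs cs ] F (φ ⊕ (w , ψ))
    ≡⟨ ∑-cong (allMaps (a ∷ as) (c ∷ cs)) (λ φ → sym (∑-concatMap-map _,_ (allVec cs′ b) (allMaps bs cs) _)) ⟩
  ∑[ φ ∈ allMaps (a ∷ as) (c ∷ cs) ] ∑[ ψ ∈ allMaps (b ∷ bs) (c ∷ cs) ] F (φ ⊕ ψ) ∎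
  where
  open ≡-Reasoning
  cs′ = List.allFin c

lookup-ext : ∀ {u v : Vec A n} → (∀ i → lookup u i ≡ lookup v i) → u ≡ v
lookup-ext {u = u} {v} u≗v =
  trans (sym (Vec.tabulate∘lookup u)) (trans (Vec.tabulate-cong u≗v) (Vec.tabulate∘lookup v))

_∘ᴹ_ : ∀ {r} {s s′ t : Vec ℕ r} → Maps s′ t → Maps s s′ → Maps s t
_∘ᴹ_ {s = []}    {s′ = []}    {t = []}    tt       tt       = tt
_∘ᴹ_ {s = _ ∷ _} {s′ = _ ∷ _} {t = _ ∷ _} (f , fs) (g , gs) = Vec.map (lookup f) g , fs ∘ᴹ gs

apply-∘ᴹ : ∀ {r} {s s′ t : Vec ℕ r} (f : Maps s′ t) (g : Maps s s′) p → apply (f ∘ᴹ g) p ≡ apply f (apply g p)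
apply-∘ᴹ {s = []}    {s′ = []}    {t = []}    tt       tt       tt      = refl
apply-∘ᴹ {s = _ ∷ _} {s′ = _ ∷ _} {t = _ ∷ _} (f , fs) (g , gs) (x , p) =
  cong₂ _,_ (Vec.lookup-map x (lookup f) g) (apply-∘ᴹ fs gs p)

∘ᴹ-cancelʳ : ∀ {r} {s s′ t : Vec ℕ r} (f : Maps s′ t) (g : Maps s s′) (h : Maps s′ s) →
  (∀ j y → mapAt g j (mapAt h j y) ≡ y) → (f ∘ᴹ g) ∘ᴹ h ≡ f
∘ᴹ-cancelʳ {s = []}    {s′ = []}    {t = []}    tt       tt       tt       g∘h≗id = refl
∘ᴹ-cancelʳ {s = _ ∷ _} {s′ = _ ∷ _} {t = _ ∷ _} (f , fs) (g , gs) (h , hs) g∘h≗id =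
  cong₂ _,_ (lookup-ext λ y → begin
               lookup (Vec.map (lookup (Vec.map (lookup f) g)) h) y ≡⟨ Vec.lookup-map y _ h ⟩
               lookup (Vec.map (lookup f) g) (lookup h y)          ≡⟨ Vec.lookup-map (lookup h y) (lookup f) g ⟩
               lookup f (lookup g (lookup h y))                    ≡⟨ cong (lookup f) (g∘h≗id Fin.zero y) ⟩
               lookup f y                                          ∎)
            (∘ᴹ-cancelʳ fs gs hs (g∘h≗id ∘ Fin.suc))
  where open ≡-Reasoning

apply-restrict : ∀ {r} {a b t : Vec ℕ r} (f : Maps (zipWith ℕ._+_ a b) t) e {p} →
  restrict a b e ≡ just p → apply f e ≡ apply (takeᴹ {b = b} f) p
apply-restrict {a = []}    {b = []}    {t = []}    tt      tt      refl = refl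
apply-restrict {a = a ∷ as} {b = b ∷ bs} {t = _ ∷ _} (v , f) (x , e) eq
  with Fin.splitAt a x in split | restrict as bs e in eq′
apply-restrict {a = a ∷ as} {b = b ∷ bs} {t = _ ∷ _} (v , f) (x , e) refl | inj₁ i | just u =
  cong₂ _,_ (trans (cong (lookup v) (sym (Fin.splitAt⁻¹-↑ˡ split))) (sym (Vec.lookup∘tabulate _ i)))
            (apply-restrict f e eq′)

takeᴹ-∘ᴹ : ∀ {r} {a b t : Vec ℕ r} (h : Maps a t) (g : Maps (zipWith ℕ._+_ a b) a) →
  IdOnFixed a b g → takeᴹ {b = b} (h ∘ᴹ g) ≡ h
takeᴹ-∘ᴹ {a = []}    {b = []}    {t = []}    tt       tt       id-on-fixed = refl
takeᴹ-∘ᴹ {a = _ ∷ _} {b = _ ∷ _} {t = _ ∷ _} (h , hs) (g , gs) id-on-fixed =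
  cong₂ _,_ (trans (Vec.tabulate-cong λ i →
                     trans (Vec.lookup-map _ (lookup h) g) (cong (lookup h) (id-on-fixed Fin.zero i)))
                   (Vec.tabulate∘lookup h))
            (takeᴹ-∘ᴹ hs gs (id-on-fixed ∘ Fin.suc))

∑-allMaps-singleEdge : ∀ {r} (t : Vec ℕ r) F →
  ∑[ f ∈ allMaps (Vec.replicate r 1) t ] F (apply f (singleEdge r)) ≡ ∑ (allTuples t) F
∑-allMaps-singleEdge []      F = refl
∑-allMaps-singleEdge {suc r} (c ∷ t) F = begin
  ∑[ f ∈ allMaps (Vec.replicate (suc r) 1) (c ∷ t) ] F (apply f (singleEdge (suc r)))
    ≡⟨ ∑-concatMap-map _,_ (allVec (List.allFin c) 1) (allMaps (Vec.replicate r 1) t) _ ⟩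
  ∑[ v ∈ allVec (List.allFin c) 1 ] ∑[ g ∈ allMaps (Vec.replicate r 1) t ]
    F (lookup v Fin.zero , apply g (singleEdge r))
    ≡⟨ ∑-concatMap-map _∷_ (List.allFin c) List.[ Vec.[] {A = Fin c} ] _ ⟩
  ∑[ x ∈ List.allFin c ] ∑[ v ∈ List.[ Vec.[] {A = Fin c} ] ] ∑[ g ∈ allMaps (Vec.replicate r 1) t ]
    F (x , apply g (singleEdge r))
    ≡⟨ ∑-cong (List.allFin c) (λ x → trans (+-identityʳ _) (∑-allMaps-singleEdge t (F ∘ (x ,_)))) ⟩
  ∑[ x ∈ List.allFin c ] ∑[ u ∈ allTuples t ] F (x , u)
    ≡⟨ sym (∑-concatMap-map _,_ (List.allFin c) (allTuples t) F) ⟩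
  ∑ (allTuples (c ∷ t)) F ∎
  where open ≡-Reasoning

applyⁿ : ∀ {r} {s t : Vec ℕ r} → Vec (Maps s t) n → Tuple s → Vec (Tuple t) n
applyⁿ fs p = Vec.map (λ f → apply f p) fs

sendsInto : ∀ {r} {s t : Vec ℕ r} → List (Tuple s) → (Vec (Tuple t) n → Bool) → Vec (Maps s t) n → Bool
sendsInto E S fs = allB (λ p → S (applyⁿ fs p)) E

data ↑-View (m n : ℕ) : Fin (m ℕ.+ n) → Set where
  left  : (i : Fin m) → ↑-View m n (i ↑ˡ n)
  right : (j : Fin n) → ↑-View m n (m ↑ʳ j)

↑-view : ∀ m n x → ↑-View m n x
↑-view m n x with Fin.splitAt m x in split
... | inj₁ i = subst (↑-View m n) (Fin.splitAt⁻¹-↑ˡ split) (left i)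
... | inj₂ j = subst (↑-View m n) (Fin.splitAt⁻¹-↑ʳ split) (right j)

module _ {a b : ℕ} (φ : Vec A a) (o ν : Vec A b) where

  lookup-oldV : ∀ x → lookup (φ Vec.++ (o Vec.++ ν)) (oldV a b x) ≡ lookup (φ Vec.++ o) x
  lookup-oldV x with ↑-view a b x
  ... | left i  rewrite Fin.splitAt-↑ˡ a i b =
    trans (Vec.lookup-++ˡ φ _ i) (sym (Vec.lookup-++ˡ φ o i))
  ... | right j rewrite Fin.splitAt-↑ʳ a b j =
    trans (Vec.lookup-++ʳ φ _ (j ↑ˡ b)) (trans (Vec.lookup-++ˡ o ν j) (sym (Vec.lookup-++ʳ φ o j)))

  lookup-copyV : ∀ x → lookup (φ Vec.++ (o Vec.++ ν)) (copyV a b x) ≡ lookup (φ Vec.++ ν) x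
  lookup-copyV x with ↑-view a b x
  ... | left i  rewrite Fin.splitAt-↑ˡ a i b =
    trans (Vec.lookup-++ˡ φ _ i) (sym (Vec.lookup-++ˡ φ ν i))
  ... | right j rewrite Fin.splitAt-↑ʳ a b j =
    trans (Vec.lookup-++ʳ φ _ (b ↑ʳ j)) (trans (Vec.lookup-++ʳ o ν j) (sym (Vec.lookup-++ʳ φ ν j)))

  lookup-isFixed : ∀ x → isFixed a b x ≡ true → lookup (φ Vec.++ o) x ≡ lookup (φ Vec.++ ν) x
  lookup-isFixed x fixed with ↑-view a b x
  ... | left i  = trans (Vec.lookup-++ˡ φ o i) (sym (Vec.lookup-++ˡ φ ν i))
  ... | right j rewrite Fin.splitAt-↑ʳ a b j with () ← fixed

apply-oldMaps : ∀ {r} {a b t : Vec ℕ r} (φ : Maps a t) (o ν : Maps b t) p →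
  apply (φ ⊕ (o ⊕ ν)) (apply (oldMaps a b) p) ≡ apply (φ ⊕ o) p
apply-oldMaps {a = []}    {b = []}    {t = []}    tt       tt       tt       tt      = refl
apply-oldMaps {a = a ∷ _} {b = b ∷ _} {t = _ ∷ _} (φ , φs) (o , os) (ν , νs) (x , p) =
  cong₂ _,_ (trans (cong (lookup (φ Vec.++ (o Vec.++ ν))) (Vec.lookup∘tabulate (oldV a b) x))
                   (lookup-oldV φ o ν x))
            (apply-oldMaps φs os νs p)

apply-copyMaps : ∀ {r} {a b t : Vec ℕ r} (φ : Maps a t) (o ν : Maps b t) p →
  apply (φ ⊕ (o ⊕ ν)) (apply (copyMaps a b) p) ≡ apply (φ ⊕ ν) p
apply-copyMaps {a = []}    {b = []}    {t = []}    tt       tt       tt       tt      = refl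
apply-copyMaps {a = a ∷ _} {b = b ∷ _} {t = _ ∷ _} (φ , φs) (o , os) (ν , νs) (x , p) =
  cong₂ _,_ (trans (cong (lookup (φ Vec.++ (o Vec.++ ν))) (Vec.lookup∘tabulate (copyV a b) x))
                   (lookup-copyV φ o ν x))
            (apply-copyMaps φs os νs p)

apply-allFixed : ∀ {r} {a b t : Vec ℕ r} (φ : Maps a t) (o ν : Maps b t) p →
  allFixed a b p ≡ true → apply (φ ⊕ o) p ≡ apply (φ ⊕ ν) p
apply-allFixed {a = []}    {b = []}    {t = []}    tt       tt       tt       tt      _ = refl
apply-allFixed {a = a ∷ _} {b = b ∷ _} {t = _ ∷ _} (φ , φs) (o , os) (ν , νs) (x , p) fixed
  with isFixed a b x in x-fixed
... | true = cong₂ _,_ (lookup-isFixed φ o ν x x-fixed) (apply-allFixed φs os νs p fixed)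

allB⁺ : ∀ (p : A → Bool) {xs} → All (T ∘ p) xs → T (allB p xs)
allB⁺ p All.[]         = tt
allB⁺ p (px All.∷ pxs) = Equivalence.from T-∧ (px , allB⁺ p pxs)

allB⁻ : ∀ (p : A → Bool) xs → T (allB p xs) → All (T ∘ p) xs
allB⁻ p []       _   = All.[]
allB⁻ p (x ∷ xs) all = let px , pxs = Equivalence.to T-∧ all in px All.∷ allB⁻ p xs pxs

All-image : ∀ {P : C → Set} {xs : List A} {ys : List B} (h : A → B) (f : A → C) (g : B → C) →
  (∀ x → g (h x) ≡ f x) → (∀ {y} → y ∈ ys → y ∈ List.map h xs) → All (P ∘ f) xs → All (P ∘ g) ys
All-image {P = P} h f g g∘h≗f ys⊆ all = All.tabulate λ y∈ys → image (∈-map⁻ h (ys⊆ y∈ys))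
  where
  image : ∀ {y} → ∃ (λ x → _ × y ≡ h x) → P (g y)
  image (x , x∈xs , refl) = subst P (sym (g∘h≗f x)) (All.lookup all x∈xs)

All-preimage : ∀ {P : C → Set} {xs : List A} {ys : List B} (h : A → B) (f : A → C) (g : B → C) →
  (∀ x → g (h x) ≡ f x) → (∀ {y} → y ∈ List.map h xs → y ∈ ys) → All (P ∘ g) ys → All (P ∘ f) xs
All-preimage {P = P} h f g g∘h≗f ⊆ys all =
  All.tabulate λ {x} x∈xs → subst P (g∘h≗f x) (All.lookup all (⊆ys (∈-map⁺ h x∈xs)))

All-section : ∀ {P : C → Set} {r} {a b : Vec ℕ r} {E} (f : Tuple (zipWith ℕ._+_ a b) → C) (g : Tuple a → C) →
  (∀ e {p} → restrict a b e ≡ just p → g p ≡ f e) → All (P ∘ f) E → All (P ∘ g) (section a b E)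
All-section {P = P} {a = a} {b} f g g≗f all =
  AllP.mapMaybe⁺ (AllP.map⁺ (All.tabulate λ {e} e∈E → restricted e (All.lookup all e∈E)))
  where
  restricted : ∀ e → P (f e) → Maybe.All (P ∘ g) (restrict a b e)
  restricted e Pfe with restrict a b e in eq
  ... | just p  = Maybe.just (subst P (sym (g≗f e eq)) Pfe)
  ... | nothing = Maybe.nothing

module _ {P : C → Set} {r} {a b : Vec ℕ r} {E : List (Tuple (zipWith ℕ._+_ a b))}
         (g : Tuple (zipWith ℕ._+_ a (zipWith ℕ._+_ b b)) → C) (f₁ f₂ : Tuple (zipWith ℕ._+_ a b) → C)
         (g∘old≗f₁ : ∀ p → g (apply (oldMaps a b) p) ≡ f₁ p)
         (g∘copy≗f₂ : ∀ p → g (apply (copyMaps a b) p) ≡ f₂ p) where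

  private
    notAllFixed? = λ p → T? (notAllFixed a b p)

  All-doubleEdges⁺ : All (P ∘ f₁) E → All (P ∘ f₂) E → All (P ∘ g) (doubleEdges a b E)
  All-doubleEdges⁺ all₁ all₂ = AllP.++⁺
    (AllP.map⁺ (All.map (λ {p} → subst P (sym (g∘old≗f₁ p))) all₁))
    (AllP.map⁺ (AllP.filter⁺ notAllFixed? (All.map (λ {p} → subst P (sym (g∘copy≗f₂ p))) all₂)))

  All-doubleEdges⁻ : (∀ p → allFixed a b p ≡ true → f₁ p ≡ f₂ p) →
    All (P ∘ g) (doubleEdges a b E) → All (P ∘ f₁) E × All (P ∘ f₂) E
  All-doubleEdges⁻ fixed⇒f₁≡f₂ all = all₁ , All.tabulate (λ {p} p∈E → from-copy p p∈E (allFixed a b p) refl)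
    where
    olds = AllP.++⁻ˡ (List.map (apply (oldMaps a b)) E) all
    copies = AllP.++⁻ʳ (List.map (apply (oldMaps a b)) E) all
    all₁ : All (P ∘ f₁) E
    all₁ = All.map (λ {p} → subst P (g∘old≗f₁ p)) (AllP.map⁻ olds)
    from-copy : ∀ p → p ∈ E → ∀ c → allFixed a b p ≡ c → P (f₂ p)
    from-copy p p∈E true  fixed = subst P (fixed⇒f₁≡f₂ p fixed) (All.lookup all₁ p∈E)
    from-copy p p∈E false fixed = subst P (g∘copy≗f₂ p) (All.lookup (AllP.map⁻ copies)
      (∈-filter⁺ notAllFixed? p∈E (subst (λ c → T (if c then false else true)) (sym fixed) tt)))

-- Distributions on homomorphisms

module _ {r : ℕ} (Q : Hypergraph r) where

  private
    t = sizes Q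
    M = numEdges Q
    open DecMembership (Tuple-≟ t) using (_∈?_)

    instance
      M-nonZero : ℕ.NonZero M
      M-nonZero with edges Q | nonempty Q
      ... | []    | E≢[] = ⊥-elim (E≢[] refl)
      ... | _ ∷ _ | _    = _

  Hom : ∀ {s : Vec ℕ r} → List (Tuple s) → Maps s t → Set
  Hom E f = All (λ p → apply f p ∈ edges Q) E

  Hom? : ∀ {s : Vec ℕ r} (E : List (Tuple s)) f → Dec (Hom E f)
  Hom? E f = All.all? (λ p → apply f p ∈? edges Q) E

  record GoodDistribution (k : ℕ) (s : Vec ℕ r) (E : List (Tuple s)) : Set where
    field
      H           : Maps s t → ℚ
      H-nonneg    : ∀ f → 0ℚ ≤ H f
      H-off-Hom   : ∀ f → ¬ Hom E f → H f ≡ 0ℚ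
      H-total     : ∑ (allMaps s t) H ≡ 1ℚ
      event-bound : ∀ n S → SubsetQn Q n S →
                    powℚ (μ Q n S) (2 ^ k) ≤ 𝔼 (allMaps s t) H n (𝟙 ∘ sendsInto E S)
      H-floor     : ∀ f → Hom E f → frac 1 (M ^ (2 ^ k)) ≤ H f

  module _ where
    private
      uniform : Tuple t → ℚ
      uniform u = if does (u ∈? edges Q) then frac 1 M else 0ℚ

      ∏-uniform : ∀ (us : Vec (Tuple t) n) → VAll (_∈ edges Q) us → ∏ uniform us ≡ powℚ (frac 1 M) n
      ∏-uniform []       VAll.[]            = refl
      ∏-uniform (u ∷ us) (u∈Q VAll.∷ us∈Q) with u ∈? edges Q
      ... | yes _   = cong (frac 1 M *_) (∏-uniform us us∈Q)
      ... | no u∉Q = ⊥-elim (u∉Q u∈Q)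

      uniform-total : ∑ (allTuples t) uniform ≡ 1ℚ
      uniform-total = begin
        ∑ (allTuples t) uniform
          ≡⟨ ∑-restrict (Tuple-≟ t) (Unique-allTuples t) (unique Q) (∈-allTuples t) (λ _ → frac 1 M) ⟩
        ∑[ u ∈ edges Q ] frac 1 M      ≡⟨ ∑-const (edges Q) (frac 1 M) ⟩
        frac M 1 * frac 1 M            ≡⟨ frac-* M 1 1 M ⟩
        frac (M ℕ.* 1) (1 ℕ.* M)       ≡⟨ cong₂ frac (ℕ.*-identityʳ M) (ℕ.*-identityˡ M) ⟩
        frac M M                       ≡⟨ frac-self M ⟩
        1ℚ                             ∎
        where open ≡-Reasoning

      uniform-event : ∀ n S → SubsetQn Q n S →
        ∑[ us ∈ allVec (allTuples t) n ] (∏ uniform us * 𝟙 (S us ∧ true)) ≡ μ Q n S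
      uniform-event n S S⊆Qⁿ = begin
        ∑[ us ∈ allVec (allTuples t) n ] (∏ uniform us * 𝟙 (S us ∧ true))
          ≡⟨ ∑-cong (allVec (allTuples t) n) in-S ⟩
        ∑[ us ∈ allVec (allTuples t) n ] (𝟙 (S us) * powℚ (frac 1 M) n)
          ≡⟨ ∑-*ʳ (allVec (allTuples t) n) _ (𝟙 ∘ S) ⟩
        ∑[ us ∈ allVec (allTuples t) n ] 𝟙 (S us) * powℚ (frac 1 M) n
          ≡⟨ cong₂ _*_ (∑-𝟙 S (allVec (allTuples t) n)) (powℚ-frac-1 M n) ⟩
        frac (count S (allVec (allTuples t) n)) 1 * frac 1 (M ^ n)
          ≡⟨ frac-* (count S (allVec (allTuples t) n)) 1 1 (M ^ n) {{_}} {{ℕ.m^n≢0 M n}} ⟩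
        frac (count S (allVec (allTuples t) n) ℕ.* 1) (1 ℕ.* M ^ n)
          ≡⟨ cong₂ frac (ℕ.*-identityʳ _) (ℕ.*-identityˡ (M ^ n)) ⟩
        μ Q n S ∎
        where
        open ≡-Reasoning
        in-S : ∀ us → ∏ uniform us * 𝟙 (S us ∧ true) ≡ 𝟙 (S us) * powℚ (frac 1 M) n
        in-S us with S us in us∈S
        ... | true  = trans (*-identityʳ _)
                      (trans (∏-uniform us (S⊆Qⁿ us (subst T (sym us∈S) tt))) (sym (*-identityˡ _)))
        ... | false = trans (*-zeroʳ (∏ uniform us)) (sym (*-zeroˡ (powℚ (frac 1 M) n)))

    single-good : GoodDistribution 0 (Vec.replicate r 1) List.[ singleEdge r ]
    single-good = record
      { H           = H
      ; H-nonneg    = λ f → uniform-nonneg (τ f)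
      ; H-off-Hom   = λ f f∉Hom → off-Q (τ f) (f∉Hom ∘ (All._∷ All.[]))
      ; H-total     = trans (∑-allMaps-singleEdge t uniform) uniform-total
      ; event-bound = λ n S S⊆Qⁿ → ≤-reflexive (sym (event n S S⊆Qⁿ))
      ; H-floor     = λ f f∈Hom → floor (τ f) (All.head f∈Hom)
      }
      where
      τ : Maps (Vec.replicate r 1) t → Tuple t
      τ f = apply f (singleEdge r)
      H : Maps (Vec.replicate r 1) t → ℚ
      H = uniform ∘ τ
      uniform-nonneg : ∀ u → 0ℚ ≤ uniform u
      uniform-nonneg u with u ∈? edges Q
      ... | yes _ = frac-nonneg 1 M
      ... | no _  = ≤-refl
      off-Q : ∀ u → ¬ u ∈ edges Q → uniform u ≡ 0ℚ
      off-Q u u∉Q with u ∈? edges Q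
      ... | yes u∈Q = ⊥-elim (u∉Q u∈Q)
      ... | no _    = refl
      floor : ∀ u → u ∈ edges Q → frac 1 (M ^ 1) ≤ uniform u
      floor u u∈Q with u ∈? edges Q
      ... | yes _   = ≤-reflexive (cong (frac 1) (ℕ.*-identityʳ M))
      ... | no u∉Q = ⊥-elim (u∉Q u∈Q)
      event : ∀ n S → SubsetQn Q n S →
        𝔼 (allMaps (Vec.replicate r 1) t) H n (𝟙 ∘ sendsInto List.[ singleEdge r ] S) ≡ powℚ (μ Q n S) 1
      event n S S⊆Qⁿ = begin
        𝔼 (allMaps (Vec.replicate r 1) t) H n (𝟙 ∘ sendsInto List.[ singleEdge r ] S)
          ≡⟨ 𝔼-map τ (∑-allMaps-singleEdge t) uniform n (λ us → 𝟙 (S us ∧ true)) ⟩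
        ∑[ us ∈ allVec (allTuples t) n ] (∏ uniform us * 𝟙 (S us ∧ true))
          ≡⟨ uniform-event n S S⊆Qⁿ ⟩
        μ Q n S
          ≡⟨ sym (*-identityʳ _) ⟩
        powℚ (μ Q n S) 1 ∎
        where open ≡-Reasoning

  rename-good : ∀ {k} {s s′ : Vec ℕ r} {E : List (Tuple s)} {E′ : List (Tuple s′)} →
    GoodDistribution k s E → (σ : Renaming s s′) →
    List.map (apply (Renaming.to σ)) E ⊆ E′ → E′ ⊆ List.map (apply (Renaming.to σ)) E →
    GoodDistribution k s′ E′
  rename-good {k} {s} {s′} {E} {E′} good σ σE⊆E′ E′⊆σE = record
    { H           = H ∘ ρ
    ; H-nonneg    = H-nonneg ∘ ρ
    ; H-off-Hom   = λ f f∉Hom → H-off-Hom (ρ f) (f∉Hom ∘ Hom-image f)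
    ; H-total     = trans (∑-ρ H) H-total
    ; event-bound = λ n S S⊆Qⁿ → begin
        powℚ (μ Q n S) (2 ^ k)                                ≤⟨ event-bound n S S⊆Qⁿ ⟩
        𝔼 (allMaps s t) H n (𝟙 ∘ sendsInto E S)               ≡⟨ sym (𝔼-map ρ ∑-ρ H n _) ⟩
        𝔼 (allMaps s′ t) (H ∘ ρ) n (𝟙 ∘ sendsInto E S ∘ Vec.map ρ)
          ≤⟨ 𝔼-mono-≤ (H-nonneg ∘ ρ) (λ fs → 𝟙-mono (sends-image S fs)) ⟩
        𝔼 (allMaps s′ t) (H ∘ ρ) n (𝟙 ∘ sendsInto E′ S)      ∎
    ; H-floor     = λ f f∈Hom → H-floor (ρ f) (Hom-preimage f f∈Hom)
    }
    where
    open GoodDistribution good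
    open Renaming σ
    open ≤-Reasoning
    ρ : Maps s′ t → Maps s t
    ρ f = f ∘ᴹ to
    ∑-ρ : ∀ F → ∑[ f ∈ allMaps s′ t ] F (ρ f) ≡ ∑ (allMaps s t) F
    ∑-ρ = ∑-reindex ρ (_∘ᴹ from) (λ f → ∘ᴹ-cancelʳ f to from to∘from) (λ f → ∘ᴹ-cancelʳ f from to from∘to)
            (Unique-allMaps s′ t) (Unique-allMaps s t) (∈-allMaps s′ t) (∈-allMaps s t)
    Hom-image : ∀ f → Hom E (ρ f) → Hom E′ f
    Hom-image f = All-image {P = _∈ edges Q} (apply to) (apply (ρ f)) (apply f) (λ p → sym (apply-∘ᴹ f to p)) E′⊆σE
    Hom-preimage : ∀ f → Hom E′ f → Hom E (ρ f)
    Hom-preimage f = All-preimage {P = _∈ edges Q} (apply to) (apply (ρ f)) (apply f) (λ p → sym (apply-∘ᴹ f to p)) σE⊆E′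
    sends-image : ∀ {n} S (fs : Vec (Maps s′ t) n) → T (sendsInto E S (Vec.map ρ fs)) → T (sendsInto E′ S fs)
    sends-image S fs =
      allB⁺ _ ∘ All-image {P = T ∘ S} (apply to) (applyⁿ (Vec.map ρ fs)) (applyⁿ fs) applyⁿ-ρ E′⊆σE ∘ allB⁻ _ E
      where
      applyⁿ-ρ : ∀ p → applyⁿ fs (apply to p) ≡ applyⁿ (Vec.map ρ fs) p
      applyⁿ-ρ p = sym (trans (sym (Vec.map-∘ _ ρ fs)) (Vec.map-cong (λ f → apply-∘ᴹ f to p) fs))

  collapse-good : ∀ {k} (a b : Vec ℕ r) {E : List (Tuple (zipWith ℕ._+_ a b))} →
    GoodDistribution k (zipWith ℕ._+_ a b) E → (g : Maps (zipWith ℕ._+_ a b) a) → IdOnFixed a b g →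
    All (λ e → apply g e ∈ section a b E) E → GoodDistribution k a (section a b E)
  collapse-good {k} a b {E} good g id-on-fixed g[E]⊆section = record
    { H           = H′
    ; H-nonneg    = λ φ → ∑-nonneg (allMaps b t) (λ ψ → H-nonneg (φ ⊕ ψ))
    ; H-off-Hom   = λ φ φ∉Hom → trans (∑-cong (allMaps b t) (λ ψ → H-off-Hom (φ ⊕ ψ) (φ∉Hom ∘ Hom-section φ ψ)))
                                     (∑-zero (allMaps b t))
    ; H-total     = trans (sym (∑-allMaps-⊕ a b t H)) H-total
    ; event-bound = λ n S S⊆Qⁿ → begin
        powℚ (μ Q n S) (2 ^ k)                                   ≤⟨ event-bound n S S⊆Qⁿ ⟩
        𝔼 (allMaps a+b t) H n (𝟙 ∘ sendsInto E S)
          ≤⟨ 𝔼-mono-≤ H-nonneg (λ fs → 𝟙-mono (sends-section S fs)) ⟩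
        𝔼 (allMaps a+b t) H n (𝟙 ∘ sendsInto (section a b E) S ∘ Vec.map takeᴹ)
          ≡⟨ 𝔼-marginal {bs = allMaps b t} _⊕_ takeᴹ takeᴹ-⊕ (∑-allMaps-⊕ a b t) H n _ ⟩
        𝔼 (allMaps a t) H′ n (𝟙 ∘ sendsInto (section a b E) S) ∎
    ; H-floor     = λ φ φ∈Hom → begin
        frac 1 (M ^ (2 ^ k))       ≤⟨ H-floor (φ ∘ᴹ g) (Hom-∘ᴹ φ φ∈Hom) ⟩
        H (φ ∘ᴹ g)                 ≡⟨ cong H (sym (∘ᴹ-extends φ)) ⟩
        H (φ ⊕ dropᴹ (φ ∘ᴹ g))     ≤⟨ ∈⇒≤∑ (λ ψ → H-nonneg (φ ⊕ ψ)) (∈-allMaps b t _) ⟩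
        H′ φ                       ∎
    }
    where
    open GoodDistribution good
    open ≤-Reasoning
    a+b = zipWith ℕ._+_ a b
    H′ : Maps a t → ℚ
    H′ = marginal (allMaps b t) (λ φ ψ → H (φ ⊕ ψ))
    Hom-section : ∀ φ ψ → Hom E (φ ⊕ ψ) → Hom (section a b E) φ
    Hom-section φ ψ = All-section {P = _∈ edges Q} (apply (φ ⊕ ψ)) (apply φ) λ e {p} restricts →
      sym (trans (apply-restrict (φ ⊕ ψ) e restricts) (cong (λ f → apply f p) (takeᴹ-⊕ φ ψ)))
    sends-section : ∀ {n} S (fs : Vec (Maps a+b t) n) →
      T (sendsInto E S fs) → T (sendsInto (section a b E) S (Vec.map takeᴹ fs))
    sends-section S fs = allB⁺ _ ∘ All-section {P = T ∘ S} (applyⁿ fs) (applyⁿ (Vec.map takeᴹ fs))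
      (λ e {p} restricts → sym (trans (Vec.map-cong (λ f → apply-restrict f e restricts) fs) (Vec.map-∘ _ takeᴹ fs)))
      ∘ allB⁻ _ E
    Hom-∘ᴹ : ∀ φ → Hom (section a b E) φ → Hom E (φ ∘ᴹ g)
    Hom-∘ᴹ φ φ∈Hom = All.tabulate λ {e} e∈E →
      subst (_∈ edges Q) (sym (apply-∘ᴹ φ g e)) (All.lookup φ∈Hom (All.lookup g[E]⊆section e∈E))
    ∘ᴹ-extends : ∀ φ → φ ⊕ dropᴹ {a = a} (φ ∘ᴹ g) ≡ φ ∘ᴹ g
    ∘ᴹ-extends φ = trans (cong (_⊕ dropᴹ {a = a} (φ ∘ᴹ g)) (sym (takeᴹ-∘ᴹ φ g id-on-fixed))) (takeᴹ⊕dropᴹ (φ ∘ᴹ g))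

  module Doubling {k} (a b : Vec ℕ r) {E : List (Tuple (zipWith ℕ._+_ a b))}
                  (good : GoodDistribution k (zipWith ℕ._+_ a b) E) where

    open GoodDistribution good

    private
      b+b = zipWith ℕ._+_ b b
      s₂  = zipWith ℕ._+_ a b+b
      E₂  = doubleEdges a b E

    H∣ : Maps a t → Maps b t → ℚ
    H∣ φ ψ = H (φ ⊕ ψ)

    w : Maps a t → ℚ
    w = marginal (allMaps b t) H∣

    K : Maps a t → Maps b t → Maps b t → ℚ
    K = coupling (allMaps b t) H∣

    H₂ : Maps s₂ t → ℚ
    H₂ f = K (takeᴹ {b = b+b} f) (takeᴹ {b = b} (dropᴹ {a = a} f)) (dropᴹ {a = b} (dropᴹ {a = a} f))

    H₂-⊕ : ∀ φ o ν → H₂ (φ ⊕ (o ⊕ ν)) ≡ K φ o ν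
    H₂-⊕ φ o ν rewrite takeᴹ-⊕ {b = b+b} φ (o ⊕ ν) | dropᴹ-⊕ {a = a} φ (o ⊕ ν)
                     | takeᴹ-⊕ {b = b} o ν | dropᴹ-⊕ {a = b} o ν = refl

    ⊕-split : ∀ (f : Maps s₂ t) →
      takeᴹ {b = b+b} f ⊕ (takeᴹ {b = b} (dropᴹ {a = a} f) ⊕ dropᴹ {a = b} (dropᴹ {a = a} f)) ≡ f
    ⊕-split f = trans (cong (takeᴹ {b = b+b} f ⊕_) (takeᴹ⊕dropᴹ (dropᴹ {a = a} f))) (takeᴹ⊕dropᴹ f)

    Hom-doubled⁺ : ∀ φ o ν → Hom E (φ ⊕ o) → Hom E (φ ⊕ ν) → Hom E₂ (φ ⊕ (o ⊕ ν))
    Hom-doubled⁺ φ o ν =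
      All-doubleEdges⁺ {P = _∈ edges Q} (apply (φ ⊕ (o ⊕ ν))) (apply (φ ⊕ o)) (apply (φ ⊕ ν))
        (apply-oldMaps φ o ν) (apply-copyMaps φ o ν)

    Hom-doubled⁻ : ∀ φ o ν → Hom E₂ (φ ⊕ (o ⊕ ν)) → Hom E (φ ⊕ o) × Hom E (φ ⊕ ν)
    Hom-doubled⁻ φ o ν =
      All-doubleEdges⁻ {P = _∈ edges Q} (apply (φ ⊕ (o ⊕ ν))) (apply (φ ⊕ o)) (apply (φ ⊕ ν))
        (apply-oldMaps φ o ν) (apply-copyMaps φ o ν) (apply-allFixed φ o ν)

    sends-doubled : ∀ {n} S (φs : Vec (Maps a t) n) os νs →
      T (sendsInto E S (zipWith _⊕_ φs os)) → T (sendsInto E S (zipWith _⊕_ φs νs)) →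
      T (sendsInto E₂ S (zipWith _⊕_ φs (zipWith _⊕_ os νs)))
    sends-doubled S φs os νs sends-o sends-ν = allB⁺ _
      (All-doubleEdges⁺ {P = T ∘ S} (applyⁿ (zipWith _⊕_ φs (zipWith _⊕_ os νs)))
        (applyⁿ (zipWith _⊕_ φs os)) (applyⁿ (zipWith _⊕_ φs νs))
        (applyⁿ-old φs os νs) (applyⁿ-copy φs os νs) (allB⁻ _ E sends-o) (allB⁻ _ E sends-ν))
      where
      applyⁿ-old : ∀ {n} (φs : Vec (Maps a t) n) os νs p →
        applyⁿ (zipWith _⊕_ φs (zipWith _⊕_ os νs)) (apply (oldMaps a b) p) ≡ applyⁿ (zipWith _⊕_ φs os) p
      applyⁿ-old []       []       []       p = refl
      applyⁿ-old (φ ∷ φs) (o ∷ os) (ν ∷ νs) p = cong₂ _∷_ (apply-oldMaps φ o ν p) (applyⁿ-old φs os νs p)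
      applyⁿ-copy : ∀ {n} (φs : Vec (Maps a t) n) os νs p →
        applyⁿ (zipWith _⊕_ φs (zipWith _⊕_ os νs)) (apply (copyMaps a b) p) ≡ applyⁿ (zipWith _⊕_ φs νs) p
      applyⁿ-copy []       []       []       p = refl
      applyⁿ-copy (φ ∷ φs) (o ∷ os) (ν ∷ νs) p = cong₂ _∷_ (apply-copyMaps φ o ν p) (applyⁿ-copy φs os νs p)

    w-nonneg : ∀ φ → 0ℚ ≤ w φ
    w-nonneg φ = ∑-nonneg (allMaps b t) (λ ψ → H-nonneg (φ ⊕ ψ))

    w-total : ∑ (allMaps a t) w ≡ 1ℚ
    w-total = trans (sym (∑-allMaps-⊕ a b t H)) H-total

    K-off-Hom : ∀ φ o ν → ¬ Hom E₂ (φ ⊕ (o ⊕ ν)) → K φ o ν ≡ 0ℚ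
    K-off-Hom φ o ν ∉Hom with Hom? E (φ ⊕ o) | Hom? E (φ ⊕ ν)
    ... | yes o∈Hom | yes ν∈Hom = ⊥-elim (∉Hom (Hom-doubled⁺ φ o ν o∈Hom ν∈Hom))
    ... | no o∉Hom  | _         = begin
      H∣ φ o * H∣ φ ν * inv (w φ) ≡⟨ cong (λ h → h * H∣ φ ν * inv (w φ)) (H-off-Hom (φ ⊕ o) o∉Hom) ⟩
      0ℚ * H∣ φ ν * inv (w φ)     ≡⟨ trans (cong (_* inv (w φ)) (*-zeroˡ (H∣ φ ν))) (*-zeroˡ (inv (w φ))) ⟩
      0ℚ                          ∎
      where open ≡-Reasoning
    ... | yes _     | no ν∉Hom  = begin
      H∣ φ o * H∣ φ ν * inv (w φ) ≡⟨ cong (λ h → H∣ φ o * h * inv (w φ)) (H-off-Hom (φ ⊕ ν) ν∉Hom) ⟩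
      H∣ φ o * 0ℚ * inv (w φ)     ≡⟨ trans (cong (_* inv (w φ)) (*-zeroʳ (H∣ φ o))) (*-zeroˡ (inv (w φ))) ⟩
      0ℚ                          ∎
      where open ≡-Reasoning

    H₂-total : ∑ (allMaps s₂ t) H₂ ≡ 1ℚ
    H₂-total = begin
      ∑ (allMaps s₂ t) H₂                                                            ≡⟨ ∑-allMaps-⊕ a b+b t H₂ ⟩
      ∑[ φ ∈ allMaps a t ] ∑[ ψ ∈ allMaps b+b t ] H₂ (φ ⊕ ψ)
        ≡⟨ ∑-cong (allMaps a t) (λ φ → ∑-allMaps-⊕ b b t (H₂ ∘ (φ ⊕_))) ⟩
      ∑[ φ ∈ allMaps a t ] ∑[ o ∈ allMaps b t ] ∑[ ν ∈ allMaps b t ] H₂ (φ ⊕ (o ⊕ ν))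
        ≡⟨ ∑-cong (allMaps a t) (λ φ → ∑-cong (allMaps b t) (λ o → ∑-cong (allMaps b t) (H₂-⊕ φ o))) ⟩
      ∑[ φ ∈ allMaps a t ] ∑[ o ∈ allMaps b t ] ∑[ ν ∈ allMaps b t ] K φ o ν
        ≡⟨ ∑-cong (allMaps a t) (∑-coupling (allMaps b t) H∣) ⟩
      ∑ (allMaps a t) w                                                              ≡⟨ w-total ⟩
      1ℚ                                                                             ∎
      where open ≡-Reasoning

    private
      2ᵏ = 2 ^ k
      floor = frac 1 (M ^ 2ᵏ)

      floor-suc : frac 1 (M ^ (2 ^ suc k)) ≡ floor * floor * 1ℚ
      floor-suc = begin
        frac 1 (M ^ (2ᵏ ℕ.+ (2ᵏ ℕ.+ 0)))     ≡⟨ cong (λ c → frac 1 (M ^ (2ᵏ ℕ.+ c))) (ℕ.+-identityʳ 2ᵏ) ⟩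
        frac 1 (M ^ (2ᵏ ℕ.+ 2ᵏ))             ≡⟨ cong (frac 1) (ℕ.^-distribˡ-+-* M 2ᵏ 2ᵏ) ⟩
        frac 1 (M ^ 2ᵏ ℕ.* M ^ 2ᵏ)           ≡⟨ sym (frac-* 1 1 (M ^ 2ᵏ) (M ^ 2ᵏ)) ⟩
        floor * floor                      ≡⟨ sym (*-identityʳ _) ⟩
        floor * floor * 1ℚ                 ∎
        where
        open ≡-Reasoning
        instance _ = ℕ.m^n≢0 M 2ᵏ

    K-floor : ∀ φ o ν → Hom E₂ (φ ⊕ (o ⊕ ν)) → frac 1 (M ^ (2 ^ suc k)) ≤ K φ o ν
    K-floor φ o ν ∈Hom = begin
      frac 1 (M ^ (2 ^ suc k))        ≡⟨ floor-suc ⟩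
      floor * floor * 1ℚ              ≤⟨ *-mono-≤-nonneg (*-nonneg floor≥0 floor≥0) (𝟙-nonneg true)
                                           (*-mono-≤-nonneg floor≥0 floor≥0 floor≤H∣φo (H-floor _ ν∈Hom))
                                           (1≤inv 0<w w≤1) ⟩
      H∣ φ o * H∣ φ ν * inv (w φ)     ∎
      where
      open ≤-Reasoning
      instance _ = ℕ.m^n≢0 M 2ᵏ
      o∈Hom = proj₁ (Hom-doubled⁻ φ o ν ∈Hom)
      ν∈Hom = proj₂ (Hom-doubled⁻ φ o ν ∈Hom)
      floor≥0 = frac-nonneg 1 (M ^ 2ᵏ)
      floor≤H∣φo = H-floor (φ ⊕ o) o∈Hom
      w≤1 : w φ ≤ 1ℚ
      w≤1 = ≤-trans (∈⇒≤∑ w-nonneg (∈-allMaps a t φ)) (≤-reflexive w-total)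
      0<w : 0ℚ < w φ
      0<w = <-≤-trans (frac-1-pos (M ^ 2ᵏ))
                      (≤-trans floor≤H∣φo (∈⇒≤∑ (λ ψ → H-nonneg (φ ⊕ ψ)) (∈-allMaps b t o)))

    Hⁿ : Vec (Maps a t) n → Vec (Maps b t) n → ℚ
    Hⁿ φs os = prodVecℚ (zipWith H∣ φs os)

    Hⁿ-nonneg : ∀ (φs : Vec (Maps a t) n) os → 0ℚ ≤ Hⁿ φs os
    Hⁿ-nonneg φs os =
      subst (0ℚ ≤_) (cong prodVecℚ (map-zipWith H _⊕_ φs os)) (∏-nonneg H-nonneg (zipWith _⊕_ φs os))

    marginalⁿ : ∀ (φs : Vec (Maps a t) n) → marginal (allVec (allMaps b t) n) Hⁿ φs ≡ ∏ w φs
    marginalⁿ = ∑-allVec-∏ H∣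

    ∏-H₂ : ∀ (φs : Vec (Maps a t) n) os νs →
      prodVecℚ (zipWith (λ φ ψ → H₂ (φ ⊕ ψ)) φs (zipWith _⊕_ os νs)) ≡
      coupling (allVec (allMaps b t) n) Hⁿ φs os νs
    ∏-H₂ []       []       []       = refl
    ∏-H₂ (φ ∷ φs) (o ∷ os) (ν ∷ νs) = begin
      H₂ (φ ⊕ (o ⊕ ν)) * prodVecℚ (zipWith (λ φ ψ → H₂ (φ ⊕ ψ)) φs (zipWith _⊕_ os νs))
        ≡⟨ cong₂ _*_ (H₂-⊕ φ o ν)
                     (trans (∏-H₂ φs os νs) (cong (λ m → Hⁿ φs os * Hⁿ φs νs * inv m) (marginalⁿ φs))) ⟩
      H∣ φ o * H∣ φ ν * inv (w φ) * (Hⁿ φs os * Hⁿ φs νs * inv (∏ w φs))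
        ≡⟨ interleave (H∣ φ o) (H∣ φ ν) (inv (w φ)) (Hⁿ φs os) (Hⁿ φs νs) (inv (∏ w φs)) ⟩
      H∣ φ o * Hⁿ φs os * (H∣ φ ν * Hⁿ φs νs) * (inv (w φ) * inv (∏ w φs))
        ≡⟨ cong (H∣ φ o * Hⁿ φs os * (H∣ φ ν * Hⁿ φs νs) *_)
                (trans (sym (inv-* (w φ) (∏ w φs))) (cong inv (sym (marginalⁿ (φ ∷ φs))))) ⟩
      coupling (allVec (allMaps b t) (suc _)) Hⁿ (φ ∷ φs) (o ∷ os) (ν ∷ νs) ∎
      where
      open ≡-Reasoning
      interleave : ∀ x y u p q v → x * y * u * (p * q * v) ≡ x * p * (y * q) * (u * v)
      interleave = solve-∀ ℚ-ring

    𝔼-H₂ : ∀ {n} (F : Vec (Maps s₂ t) n → ℚ) → 𝔼 (allMaps s₂ t) H₂ n F ≡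
      ∑[ φs ∈ allVec (allMaps a t) n ] ∑[ os ∈ allVec (allMaps b t) n ] ∑[ νs ∈ allVec (allMaps b t) n ]
        (coupling (allVec (allMaps b t) n) Hⁿ φs os νs * F (zipWith _⊕_ φs (zipWith _⊕_ os νs)))
    𝔼-H₂ {n} F = trans (𝔼-split {bs = allMaps b+b t} _⊕_ (∑-allMaps-⊕ a b+b t) H₂ n F)
      (∑-cong (allVec (allMaps a t) n) λ φs →
        trans (∑-allVec-zipWith {as = allMaps b t} {bs = allMaps b t} _⊕_ (∑-allMaps-⊕ b b t) n _)
              (∑-cong (allVec (allMaps b t) n) λ os → ∑-cong (allVec (allMaps b t) n) λ νs →
                cong (_* F (zipWith _⊕_ φs (zipWith _⊕_ os νs))) (∏-H₂ φs os νs)))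

    H₂-event-bound : ∀ n S → SubsetQn Q n S →
      powℚ (μ Q n S) (2 ^ suc k) ≤ 𝔼 (allMaps s₂ t) H₂ n (𝟙 ∘ sendsInto E₂ S)
    H₂-event-bound n S S⊆Qⁿ = begin
      powℚ (μ Q n S) (2 ^ suc k)                             ≡⟨ powℚ-2^suc (μ Q n S) k ⟩
      powℚ (μ Q n S) (2 ^ k) * powℚ (μ Q n S) (2 ^ k)
        ≤⟨ *-mono-≤-nonneg μᶜ≥0 μᶜ≥0 (event-bound n S S⊆Qⁿ) (event-bound n S S⊆Qⁿ) ⟩
      Pr * Pr                                                ≡⟨ cong₂ _*_ Pr-split Pr-split ⟩
      Pr′ * Pr′                                              ≤⟨ coupling-square Lbⁿ Hⁿ Laⁿ Hⁿ-nonneg ∑marginalⁿ≡1 ev ⟩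
      ∑[ φs ∈ Laⁿ ] ∑[ os ∈ Lbⁿ ] ∑[ νs ∈ Lbⁿ ] (coupling Lbⁿ Hⁿ φs os νs * 𝟙 (ev φs os ∧ ev φs νs))
        ≤⟨ ∑-mono-≤ Laⁿ (λ φs → ∑-mono-≤ Lbⁿ (λ os → ∑-mono-≤ Lbⁿ (λ νs →
             *-monoˡ-≤-nonNeg (coupling Lbⁿ Hⁿ φs os νs)
               {{nonNegative (coupling-nonneg Lbⁿ Hⁿ Hⁿ-nonneg φs os νs)}}
               (𝟙-mono (λ both → sends-doubled S φs os νs (proj₁ (Equivalence.to T-∧ both))
                                                          (proj₂ (Equivalence.to T-∧ both))))))) ⟩
      ∑[ φs ∈ Laⁿ ] ∑[ os ∈ Lbⁿ ] ∑[ νs ∈ Lbⁿ ]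
        (coupling Lbⁿ Hⁿ φs os νs * 𝟙 (sendsInto E₂ S (zipWith _⊕_ φs (zipWith _⊕_ os νs))))
                                                             ≡⟨ sym (𝔼-H₂ (𝟙 ∘ sendsInto E₂ S)) ⟩
      𝔼 (allMaps s₂ t) H₂ n (𝟙 ∘ sendsInto E₂ S)            ∎
      where
      open ≤-Reasoning
      Laⁿ = allVec (allMaps a t) n
      Lbⁿ = allVec (allMaps b t) n
      μᶜ≥0 = powℚ-nonneg (2 ^ k) (frac-nonneg _ (M ^ n))
      ev : Vec (Maps a t) n → Vec (Maps b t) n → Bool
      ev φs os = sendsInto E S (zipWith _⊕_ φs os)
      Pr  = 𝔼 (allMaps (zipWith ℕ._+_ a b) t) H n (𝟙 ∘ sendsInto E S)
      Pr′ = ∑[ φs ∈ Laⁿ ] ∑[ os ∈ Lbⁿ ] (Hⁿ φs os * 𝟙 (ev φs os))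
      Pr-split : Pr ≡ Pr′
      Pr-split = 𝔼-split {bs = allMaps b t} _⊕_ (∑-allMaps-⊕ a b t) H n _
      ∑marginalⁿ≡1 : ∑ Laⁿ (marginal Lbⁿ Hⁿ) ≡ 1ℚ
      ∑marginalⁿ≡1 = trans (∑-cong Laⁿ marginalⁿ) (∑-allVec-total w-total n)

    double-good : GoodDistribution (suc k) s₂ E₂
    double-good = record
      { H           = H₂
      ; H-nonneg    = λ f → coupling-nonneg (allMaps b t) H∣ (λ φ ψ → H-nonneg (φ ⊕ ψ)) _ _ _
      ; H-off-Hom   = λ f f∉Hom → K-off-Hom _ _ _ (f∉Hom ∘ subst (Hom E₂) (⊕-split f))
      ; H-total     = H₂-total
      ; event-bound = H₂-event-bound
      ; H-floor     = λ f f∈Hom → K-floor _ _ _ (subst (Hom E₂) (sym (⊕-split f)) f∈Hom)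
      }

  constructible⇒good : ∀ {k s E} → Constructible k s E → GoodDistribution k s E
  constructible⇒good single                          = single-good
  constructible⇒good (doubling a b E c)              = Doubling.double-good a b (constructible⇒good c)
  constructible⇒good (collapse a b E c g id-on-fixed g[E]⊆section) =
    collapse-good a b (constructible⇒good c) g id-on-fixed g[E]⊆section
  constructible⇒good (rename E E′ c σ σE⊆E′ E′⊆σE)  = rename-good (constructible⇒good c) σ σE⊆E′ E′⊆σE

-- The event bound holds for n = 0 as well.
lemma6p13 : (r k : ℕ) (P Q : Hypergraph r) → ConstructibleHG k P →
    Σ (Maps (sizes P) (sizes Q) → ℚ) (λ H →
      IsDistribution P Q H ×
      ((n : ℕ) → 1 Data.Nat.≤ n → (S : Vec (Tuple (sizes Q)) n → Bool) →
         SubsetQn Q n S →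
         powℚ (μ Q n S) (2 ^ k) ≤ probAll P Q H n S) ×
      ((f : Maps (sizes P) (sizes Q)) → IsHom P Q f →
         frac 1 (numEdges Q ^ (2 ^ k)) ≤ H f))
lemma6p13 r k P Q P-constructible =
  H , (H-nonneg , H-off-Hom , H-total) , (λ n _ → event-bound n) , H-floor
  where open GoodDistribution (constructible⇒good Q P-constructible)
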